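{- Let $2\le k\le n-2$ and $A\subseteq[n]$. For any $i \in [n]$, the positroid associated to the Le-diagram $D_{k,n}(A)$ has $C_{k,n}^{(i)}$ as a basis if and only if $i \notin A$.
   Context: $C_{k,n}^{(i)}=\{i,i+1,\dots,i+k-1\}$ modulo $n$ with representatives in $[n]$. A Le-diagram is a filling of a (left-justified, largest row on top) Young diagram fitting in a $k\times(n-k)$ box, each box empty or containing a dot, such that for $i<i'$, $j<j'$, if box $(i',j')$ exists and boxes $(i,j')$, $(i',j)$ have dots then $(i',j')$ has a dot. $D_{k,n}(A)$: number $n$ cells of the $k\times(n-k)$ rectangle by giving the lower-right corner cell $1$, the top-row cells from right to left $2,\dots,n-k+1$, and the leftmost-column cells from top to bottom $n-k+1,\dots,n$; start from the rectangle filled entirely with dots and remove the dot in cell numbered $i$ for each $i\in A$, and if $1\in A$ also remove the lower-right cell from the shape. Positroid of a Le-diagram $D$ in the $k\times(n-k)$ box: the southeast boundary of the shape together with (possibly) portions of the top and left sides of the box forms a lattice path from the top-right to the bottom-left corner of the box; label its steps $1,\dots,n$ in order. Vertical steps are sources (the source of a row sits at the row's right end), horizontal steps are sinks (the sink of a column sits at its bottom end); the dots are internal vertices. In each row, the source and the dots of that row, ordered right to left, are joined consecutively by edges directed leftwards; in each column, the dots and the sink of that column, ordered top to bottom, are joined consecutively by edges directed downwards. With $I$ the set of sources ($|I|=k$), a disjoint path system is a family $(p_i)_{i\in I}$ of directed paths, $p_i$ starting at $i$, ending at a sink or being the trivial path at $i$, pairwise vertex-disjoint; it realizes the set of endpoints.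 The positroid of $D$ is the matroid on $[n]$ whose bases are the sets realized by disjoint path systems. -}

module Defs where

open import Data.Nat using (ℕ; zero; suc; _+_; _∸_; _≤_; _<_; _≤?_; _≡ᵇ_)
open import Data.Bool using (Bool; true; false; not; if_then_else_; _∧_)
open import Data.List using (List; []; _∷_; _++_; length; filter; applyUpTo)
open import Data.List.Membership.Propositional using (_∈_)
open import Data.Product using (Σ; ∃; _×_; _,_)
open import Data.Sum using (_⊎_)
open import Data.Empty using (⊥)
open import Relation.Binary.PropositionalEquality using (_≡_; _≢_)
open import Function.Bundles using (_⇔_)

-- Fillings of Young diagrams inside a k × m box (m = n - k).
-- Rows are numbered 1..k from top to bottom, columns 1..m from left to
-- right.  The shape is given by its row lengths (row r has cells
-- (r,1),…,(r, len r)); `dot r c` says whether cell (r,c) carries a dot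
-- (only meaningful for cells of the shape).

record Filling : Set where
  field
    rows : ℕ
    cols : ℕ
    len  : ℕ → ℕ
    dot  : ℕ → ℕ → Bool

open Filling public

IsDot : Filling → ℕ → ℕ → Set
IsDot D r c = (1 ≤ r × r ≤ rows D) × (1 ≤ c × c ≤ len D r) × dot D r c ≡ true

data Vtx : Set where
  src : ℕ → Vtx          -- source of row r (at the right end of row r)
  snk : ℕ → Vtx          -- sink of column c (at the bottom of column c)
  dt  : ℕ → ℕ → Vtx

data Edge (D : Filling) : Vtx → Vtx → Set where
  srcE : ∀ {r c} → IsDot D r c → (∀ c' → c < c' → IsDot D r c' → ⊥) →
         Edge D (src r) (dt r c)
  rowE : ∀ {r c c'} → IsDot D r c → IsDot D r c' → c' < c →
         (∀ c'' → c' < c'' → c'' < c → IsDot D r c'' → ⊥) →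
         Edge D (dt r c) (dt r c')
  colE : ∀ {r r' c} → IsDot D r c → IsDot D r' c → r < r' →
         (∀ r'' → r < r'' → r'' < r' → IsDot D r'' c → ⊥) →
         Edge D (dt r c) (dt r' c)
  snkE : ∀ {r c} → IsDot D r c → (∀ r' → r < r' → IsDot D r' c → ⊥) →
         Edge D (dt r c) (snk c)

data Path (D : Filling) : Vtx → Vtx → Set where
  here : ∀ {u} → Path D u u
  step : ∀ {u w v} → Edge D u w → Path D w v → Path D u v

verts : ∀ {D u v} → Path D u v → List Vtx
verts {u = u} here = u ∷ []
verts {u = u} (step _ p) = u ∷ verts p

-- Labels of the steps of the boundary lattice path.
-- The path goes from the top-right corner to the bottom-left corner of
-- the box; its steps are labelled 1..n in order.  The vertical step of
-- row r is preceded by the r-1 vertical steps of the rows above and the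
-- horizontal steps of the columns c > len r; the horizontal step of
-- column c is preceded by the horizontal steps of the columns c' > c and
-- the vertical steps of the rows r with len r ≥ c.

srcLabel : Filling → ℕ → ℕ
srcLabel D r = r + (cols D ∸ len D r)

snkLabel : Filling → ℕ → ℕ
snkLabel D c =
  (cols D ∸ c) + length (filter (λ r → c ≤? len D r) (applyUpTo suc (rows D))) + 1

label : Filling → Vtx → ℕ
label D (src r) = srcLabel D r
label D (snk c) = snkLabel D c
label D (dt _ _) = 0

record PathSystem (D : Filling) : Set where
  field
    end      : ℕ → Vtx
    path     : ∀ r → 1 ≤ r → r ≤ rows D → Path D (src r) (end r)
    endOK    : ∀ r → 1 ≤ r → r ≤ rows D →
               end r ≡ src r ⊎ ∃ λ c → (1 ≤ c × c ≤ cols D) × end r ≡ snk c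
    disjoint : ∀ r r' (h₁ : 1 ≤ r) (h₂ : r ≤ rows D) (h₁' : 1 ≤ r') (h₂' : r' ≤ rows D) →
               r ≢ r' → ∀ v → v ∈ verts (path r h₁ h₂) → v ∈ verts (path r' h₁' h₂') → ⊥

open PathSystem public

Realized : ∀ {D} → PathSystem D → ℕ → Set
Realized {D} P x = ∃ λ r → (1 ≤ r × r ≤ rows D) × label D (end P r) ≡ x

IsBasis : Filling → (ℕ → Set) → Set
IsBasis D B = Σ (PathSystem D) λ P → ∀ x → B x ⇔ Realized P x

-- The cyclic interval C_{k,n}^{(i)} = {i, …, i+k-1} mod n, reps in [n].
-- For i ∈ [n] and j < k ≤ n, the representative of i+j is i+j or i+j-n.

Cyc : ℕ → ℕ → ℕ → ℕ → Set
Cyc k n i x = (1 ≤ x × x ≤ n) × ∃ λ j → j < k × (x ≡ i + j ⊎ x + n ≡ i + j)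

-- D_{k,n}(A), with A ⊆ [n] given by its characteristic function.
-- Cell numbering (m = n - k): (k,m) ↦ 1; top row (1,c) ↦ m - c + 2;
-- leftmost column (r,1) ↦ m + r.  All cells get a dot except numbered
-- cells whose number lies in A; if 1 ∈ A the cell (k,m) is removed.

Dkn : ℕ → ℕ → (ℕ → Bool) → Filling
Dkn k n A = record
  { rows = k
  ; cols = m
  ; len  = λ r → if (r ≡ᵇ k) ∧ A 1 then m ∸ 1 else m
  ; dot  = λ r c →
      if (r ≡ᵇ k) ∧ (c ≡ᵇ m) then not (A 1)
      else if r ≡ᵇ 1 then not (A ((m ∸ c) + 2))
      else if c ≡ᵇ 1 then not (A (m + r))
      else true
  }
  where m = n ∸ k

module Submission where

-- Let (a, b) be the cell numbered i.  The sources whose labels leave C^{(i)} are those of a run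
-- of rows a, …, a + p − 1, and the sinks whose labels enter it are those of the columns
-- b, …, b + p − 1, so C^{(i)} is a basis exactly when these p sources can be routed disjointly
-- to these p sinks.  If i ∉ A, all diagonal cells (a + t, b + t) carry dots, and the hooks
-- through them (along row a + t to column b + t, then down to its sink) are disjoint.  If i ∈ A,
-- the cell (a, b) is empty; every other missing dot lies in the top row, the left column or the
-- cut corner, so a path from a row of the block to a column of the block cannot step across the
-- diagonal and passes through one of the p − 1 dots (a + s, b + s) with 1 ≤ s < p: two of the
-- p paths meet.  For i = 1, either C^{(1)} is the set of all sources, or 1 ∈ A and the source of
-- row k would have to reach column m, which the shortened row k no longer does.

open import Defs
open import Data.Nat using (ℕ; zero; suc; pred; _+_; _∸_; _≤_; _<_; z≤n; s≤s; _≡ᵇ_; >-nonZero)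
open import Data.Nat.Properties
open import Data.Nat.Induction using (<-wellFounded)
open import Data.Nat.Tactic.RingSolver using (solve)
open import Induction.WellFounded using (Acc; acc)
open import Data.Bool using (Bool; true; false; not)
import Data.Bool.Properties as Bool
open import Data.List using ([]; _∷_; length; filter; applyUpTo)
open import Data.List.Properties using (filter-accept; filter-reject; filter-all; length-applyUpTo)
import Data.List.Relation.Unary.All.Properties as All
open import Data.List.Membership.Propositional using (_∈_)
open import Data.List.Relation.Unary.Any using (here; there)
open import Data.List.Relation.Unary.All as All using (All)
open import Data.Product using (Σ; ∃; ∃₂; _×_; _,_; proj₁; proj₂)
open import Data.Fin using (Fin; toℕ; fromℕ<)
open import Data.Fin.Properties using (toℕ<n; toℕ-fromℕ<; pigeonhole)
open import Data.Sum using (_⊎_; inj₁; inj₂)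
open import Data.Empty using (⊥; ⊥-elim)
open import Function using (_∘_; id)
open import Function.Bundles using (_⇔_; mk⇔; Equivalence)
open import Relation.Nullary using (¬_; Dec; yes; no)
open import Relation.Nullary.Decidable using (_×-dec_)
open import Relation.Unary using (Decidable)
open import Relation.Binary.Definitions using (tri<; tri≈; tri>)
open import Relation.Binary.PropositionalEquality
  using (_≡_; _≢_; refl; sym; trans; cong; cong₂; subst; subst₂; module ≡-Reasoning)

-- Linear facts over ℕ are certified by adding up hypotheses into SL ≤ SR and checking
-- a ring identity relating both sides, which the ring solver closes.
≤-by-certificate : ∀ {L R SL SR} c → SL ≤ SR → L + SR + c ≡ R + SL → L ≤ R
≤-by-certificate {L} {R} {SL} {SR} c SL≤SR eq =
  +-cancelʳ-≤ SR L R (≤-trans (m≤m+n (L + SR) c) (subst (_≤ R + SR) (sym eq) (+-monoʳ-≤ R SL≤SR)))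

⊥-by-certificate : ∀ {SL SR} c → SL ≤ SR → SR + suc c ≡ SL → ⊥
⊥-by-certificate {SL} {SR} c SL≤SR eq = <⇒≱ (m<m+n SR (s≤s z≤n)) (subst (_≤ SR) (sym eq) SL≤SR)

≡ᵇ⇒≡′ : ∀ {x y} → (x ≡ᵇ y) ≡ true → x ≡ y
≡ᵇ⇒≡′ {x} {y} x≡ᵇy = ≡ᵇ⇒≡ x y (Equivalence.from Bool.T-≡ x≡ᵇy)

≡ᵇ-refl : ∀ x → (x ≡ᵇ x) ≡ true
≡ᵇ-refl x = Equivalence.to Bool.T-≡ (≡⇒≡ᵇ x x refl)

≢⇒≡ᵇ-false : ∀ {x y} → x ≢ y → (x ≡ᵇ y) ≡ false
≢⇒≡ᵇ-false {x} {y} x≢y = Bool.¬-not (x≢y ∘ ≡ᵇ⇒≡′)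

not≡true⇔≢true : ∀ {b} → not b ≡ true ⇔ (¬ b ≡ true)
not≡true⇔≢true {false} = mk⇔ (λ _ ()) (λ _ → refl)
not≡true⇔≢true {true} = mk⇔ (λ ()) (λ ¬true → ⊥-elim (¬true refl))

both-true⇔ : ∀ {P Q : Set} → P → Q → P ⇔ Q
both-true⇔ p q = mk⇔ (λ _ → q) (λ _ → p)

both-false⇔ : ∀ {P Q : Set} → ¬ P → ¬ Q → P ⇔ Q
both-false⇔ ¬p ¬q = mk⇔ (⊥-elim ∘ ¬p) (⊥-elim ∘ ¬q)

outsideWindow⇔ : ∀ {a p r} → a ≤ r → (¬ (a ≤ r × r < a + p)) ⇔ (a + p ≤ r)
outsideWindow⇔ a≤r = mk⇔
  (λ outside → ≮⇒≥ λ r<a+p → outside (a≤r , r<a+p))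
  (λ a+p≤r (_ , r<a+p) → <⇒≱ r<a+p a+p≤r)

length-filter-applyUpTo-butLast : ∀ {P : ℕ → Set} (P? : Decidable P) q (f : ℕ → ℕ) →
  (∀ j → suc j < q → P (f j)) → ¬ P (f (pred q)) → length (filter P? (applyUpTo f q)) ≡ pred q
length-filter-applyUpTo-butLast P? zero f _ _ = refl
length-filter-applyUpTo-butLast P? (suc zero) f _ ¬last rewrite filter-reject P? {xs = []} ¬last = refl
length-filter-applyUpTo-butLast P? (suc (suc q)) f accept ¬last =
  trans (cong length (filter-accept P? (accept 0 (s≤s (s≤s z≤n)))))
        (cong suc (length-filter-applyUpTo-butLast P? (suc q) (f ∘ suc) (λ j → accept (suc j) ∘ s≤s) ¬last))

module BoundedSearch {P : ℕ → Set} (P? : Decidable P) where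

  greatest : ∀ {c} t → P c → c ≤ t →
             Σ ℕ λ y → P y × c ≤ y × y ≤ t × (∀ y' → y < y' → y' ≤ t → ¬ P y')
  greatest {c} t pc c≤t with P? t | m≤n⇒m<n∨m≡n c≤t
  ... | yes pt | _ = t , pt , c≤t , ≤-refl , λ y' t<y' y'≤t _ → <⇒≱ t<y' y'≤t
  ... | no ¬pt | inj₂ refl = ⊥-elim (¬pt pc)
  greatest {c} (suc t) pc _ | no ¬pt | inj₁ (s≤s c≤t) with greatest t pc c≤t
  ... | y , py , c≤y , y≤t , maximal = y , py , c≤y , m≤n⇒m≤1+n y≤t , maximal′
    where
    maximal′ : ∀ y' → y < y' → y' ≤ suc t → ¬ P y'
    maximal′ y' y<y' y'≤1+t with m≤n⇒m<n∨m≡n y'≤1+t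
    ... | inj₁ y'<1+t = maximal y' y<y' (≤-pred y'<1+t)
    ... | inj₂ refl = ¬pt

  least : ∀ lo hi → (Σ ℕ λ y → P y × lo ≤ y × y ≤ hi × (∀ y' → lo ≤ y' → y' < y → ¬ P y'))
                  ⊎ (∀ y → lo ≤ y → y ≤ hi → ¬ P y)
  least lo zero with (lo ≤? 0) ×-dec P? 0
  ... | yes (lo≤0 , p0) = inj₁ (0 , p0 , lo≤0 , z≤n , λ _ _ ())
  ... | no ¬found = inj₂ λ { y lo≤y z≤n py → ¬found (lo≤y , py) }
  least lo (suc hi) with least lo hi
  ... | inj₁ (y , py , lo≤y , y≤hi , minimal) = inj₁ (y , py , lo≤y , m≤n⇒m≤1+n y≤hi , minimal)
  ... | inj₂ none with (lo ≤? suc hi) ×-dec P? (suc hi)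
  ...   | yes (lo≤ , ph) =
    inj₁ (suc hi , ph , lo≤ , ≤-refl , λ y' lo≤y' y'<1+hi → none y' lo≤y' (≤-pred y'<1+hi))
  ...   | no ¬found = inj₂ none′
    where
    none′ : ∀ y → lo ≤ y → y ≤ suc hi → ¬ P y
    none′ y lo≤y y≤1+hi with m≤n⇒m<n∨m≡n y≤1+hi
    ... | inj₁ y<1+hi = none y lo≤y (≤-pred y<1+hi)
    ... | inj₂ refl = λ py → ¬found (lo≤y , py)

module PathsIn (D : Filling) where
  open BoundedSearch

  isDot? : ∀ r c → Dec (IsDot D r c)
  isDot? r c =
    ((1 ≤? r) ×-dec (r ≤? rows D)) ×-dec (((1 ≤? c) ×-dec (c ≤? len D r)) ×-dec (dot D r c Bool.≟ true))

  column≤len : ∀ {r c} → IsDot D r c → c ≤ len D r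
  column≤len (_ , (_ , c≤len) , _) = c≤len

  row≤rows : ∀ {r c} → IsDot D r c → r ≤ rows D
  row≤rows ((_ , r≤rows) , _) = r≤rows

  _++ₚ_ : ∀ {u w v} → Path D u w → Path D w v → Path D u v
  here ++ₚ q = q
  step e p ++ₚ q = step e (p ++ₚ q)

  All-++ₚ : ∀ {P : Vtx → Set} {u w v} (p : Path D u w) (q : Path D w v) →
            All P (verts p) → All P (verts q) → All P (verts (p ++ₚ q))
  All-++ₚ here q _ allq = allq
  All-++ₚ (step e p) q (pu All.∷ allp) allq = pu All.∷ All-++ₚ p q allp allq

  OnRow : ℕ → ℕ → Vtx → Set
  OnRow r c v = ∃ λ z → c ≤ z × v ≡ dt r z

  OnColumn : ℕ → ℕ → Vtx → Set
  OnColumn r c v = (∃ λ z → r ≤ z × v ≡ dt z c) ⊎ v ≡ snk c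

  Hook : ℕ → ℕ → Vtx → Set
  Hook r c v = v ≡ src r ⊎ OnRow r c v ⊎ OnColumn r c v

  OnColumn-mono : ∀ {r r' c v} → r ≤ r' → OnColumn r' c v → OnColumn r c v
  OnColumn-mono r≤r' (inj₁ (z , r'≤z , v≡)) = inj₁ (z , ≤-trans r≤r' r'≤z , v≡)
  OnColumn-mono r≤r' (inj₂ v≡) = inj₂ v≡

  rowPath : ∀ {r y c} → Acc _<_ y → IsDot D r y → IsDot D r c → c ≤ y →
            Σ (Path D (dt r y) (dt r c)) λ q → All (OnRow r c) (verts q)
  rowPath {r} {y} {c} (acc rs) dy dc c≤y with m≤n⇒m<n∨m≡n c≤y
  ... | inj₂ refl = here , (c , ≤-refl , refl) All.∷ All.[]
  ... | inj₁ (s≤s c≤y') with greatest (isDot? r) _ dc c≤y'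
  ...   | z , dz , c≤z , z≤y' , maximal with rowPath (rs (s≤s z≤y')) dz dc c≤z
  ...     | q , onq = step (rowE dy dz (s≤s z≤y') gap) q , (y , c≤y , refl) All.∷ onq
    where
    gap : ∀ c'' → z < c'' → c'' < y → ¬ IsDot D r c''
    gap c'' z<c'' c''<y = maximal c'' z<c'' (≤-pred c''<y)

  columnPath : ∀ {x c} → Acc _<_ (rows D ∸ x) → IsDot D x c →
               Σ (Path D (dt x c) (snk c)) λ q → All (OnColumn x c) (verts q)
  columnPath {x} {c} (acc rs) dx with least (λ z → isDot? z c) (suc x) (rows D)
  ... | inj₂ none = step (snkE dx lowest) here , inj₁ (x , ≤-refl , refl) All.∷ inj₂ refl All.∷ All.[]
    where
    lowest : ∀ r' → x < r' → ¬ IsDot D r' c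
    lowest r' x<r' dr' = none r' x<r' (row≤rows dr') dr'
  ... | inj₁ (z , dz , x<z , z≤rows , minimal) with columnPath (rs (∸-monoʳ-< x<z z≤rows)) dz
  ...   | q , onq = step (colE dx dz x<z minimal) q
                  , inj₁ (x , ≤-refl , refl) All.∷ All.map (OnColumn-mono (<⇒≤ x<z)) onq

  hookPath : ∀ {r c} → IsDot D r c → Σ (Path D (src r) (snk c)) λ q → All (Hook r c) (verts q)
  hookPath {r} {c} dc with greatest (isDot? r) (len D r) dc (column≤len dc)
  ... | y , dy , c≤y , _ , rightmost
    with rowPath (<-wellFounded y) dy dc c≤y | columnPath (<-wellFounded _) dc
  ... | q₁ , on₁ | q₂ , on₂ =
    step (srcE dy λ c' y<c' dc' → rightmost c' y<c' (column≤len dc') dc') (q₁ ++ₚ q₂) ,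
    inj₁ refl All.∷ All-++ₚ q₁ q₂ (All.map (λ h → inj₂ (inj₁ h)) on₁) (All.map (λ h → inj₂ (inj₂ h)) on₂)

  sinkColumn≤ : ∀ {x y c} → Path D (dt x y) (snk c) → c ≤ y
  sinkColumn≤ (step (rowE _ _ y'<y _) q) = ≤-trans (sinkColumn≤ q) (<⇒≤ y'<y)
  sinkColumn≤ (step (colE _ _ _ _) q) = sinkColumn≤ q
  sinkColumn≤ (step (snkE _ _) here) = ≤-refl

  reachableColumn≤len : ∀ {r v c} → Path D (src r) v → v ≡ snk c → c ≤ len D r
  reachableColumn≤len (step (srcE dy _) q) refl = ≤-trans (sinkColumn≤ q) (column≤len dy)

  hooks-disjoint : ∀ {r r' c c' v} → r < r' → c < c' → Hook r c v → Hook r' c' v → ⊥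
  hooks-disjoint r<r' _ (inj₁ refl) (inj₁ refl) = <-irrefl refl r<r'
  hooks-disjoint _ _ (inj₁ refl) (inj₂ (inj₁ (_ , _ , ())))
  hooks-disjoint _ _ (inj₁ refl) (inj₂ (inj₂ (inj₁ (_ , _ , ()))))
  hooks-disjoint _ _ (inj₁ refl) (inj₂ (inj₂ (inj₂ ())))
  hooks-disjoint _ _ (inj₂ (inj₁ (_ , _ , refl))) (inj₁ ())
  hooks-disjoint r<r' _ (inj₂ (inj₁ (_ , _ , refl))) (inj₂ (inj₁ (_ , _ , refl))) = <-irrefl refl r<r'
  hooks-disjoint r<r' _ (inj₂ (inj₁ (_ , _ , refl))) (inj₂ (inj₂ (inj₁ (_ , r'≤r , refl)))) =
    <-irrefl refl (<-≤-trans r<r' r'≤r)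
  hooks-disjoint _ _ (inj₂ (inj₁ (_ , _ , refl))) (inj₂ (inj₂ (inj₂ ())))
  hooks-disjoint _ _ (inj₂ (inj₂ (inj₁ (_ , _ , refl)))) (inj₁ ())
  hooks-disjoint _ c<c' (inj₂ (inj₂ (inj₁ (_ , _ , refl)))) (inj₂ (inj₁ (_ , c'≤c , refl))) =
    <-irrefl refl (<-≤-trans c<c' c'≤c)
  hooks-disjoint _ c<c' (inj₂ (inj₂ (inj₁ (_ , _ , refl)))) (inj₂ (inj₂ (inj₁ (_ , _ , refl)))) = <-irrefl refl c<c'
  hooks-disjoint _ _ (inj₂ (inj₂ (inj₁ (_ , _ , refl)))) (inj₂ (inj₂ (inj₂ ())))
  hooks-disjoint _ _ (inj₂ (inj₂ (inj₂ refl))) (inj₁ ())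
  hooks-disjoint _ _ (inj₂ (inj₂ (inj₂ refl))) (inj₂ (inj₁ (_ , _ , ())))
  hooks-disjoint _ _ (inj₂ (inj₂ (inj₂ refl))) (inj₂ (inj₂ (inj₁ (_ , _ , ()))))
  hooks-disjoint _ c<c' (inj₂ (inj₂ (inj₂ refl))) (inj₂ (inj₂ (inj₂ refl))) = <-irrefl refl c<c'

  source∉otherHook : ∀ {r r' c'} → r ≢ r' → ¬ Hook r' c' (src r)
  source∉otherHook r≢r' (inj₁ refl) = r≢r' refl
  source∉otherHook _ (inj₂ (inj₁ (_ , _ , ())))
  source∉otherHook _ (inj₂ (inj₂ (inj₁ (_ , _ , ()))))
  source∉otherHook _ (inj₂ (inj₂ (inj₂ ())))

  -- (x, y) lies strictly above the diagonal through (a, b) when x + b < y + a.  A path to a sink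
  -- in the column window [b, b + p) that starts weakly above the diagonal must land on it: edges
  -- cannot jump across it, and the path cannot leave the diagram from strictly above it.
  module DiagonalCrossing (a b p : ℕ)
    (no-jump : ∀ {x y x' y'} → Edge D (dt x y) (dt x' y') →
               a ≤ x → b ≤ y' → x + b < y + a → x' + b ≤ y' + a)
    (no-exit : ∀ {x y} → Edge D (dt x y) (snk y) →
               a ≤ x → b ≤ y → y < b + p → x + b < y + a → ⊥) where

    meets-diagonal : ∀ {x y c} (q : Path D (dt x y) (snk c)) → IsDot D x y → a ≤ x →
                     b ≤ c → c < b + p → x + b ≤ y + a →
                     Σ ℕ λ x' → Σ ℕ λ y' → IsDot D x' y' × a ≤ x' × x' + b ≡ y' + a × dt x' y' ∈ verts q
    meets-diagonal {x} {y} q dxy a≤x b≤c c<b+p weaklyAbove with m≤n⇒m<n∨m≡n weaklyAbove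
    meets-diagonal {x} {y} (step _ _) dxy a≤x _ _ _ | inj₂ onDiagonal = x , y , dxy , a≤x , onDiagonal , here refl
    meets-diagonal (step e@(rowE _ dz _ _) q) _ a≤x b≤c c<b+p _ | inj₁ above
      with meets-diagonal q dz a≤x b≤c c<b+p (no-jump e a≤x (≤-trans b≤c (sinkColumn≤ q)) above)
    ... | x' , y' , d' , a≤x' , onDiagonal , x'y'∈q = x' , y' , d' , a≤x' , onDiagonal , there x'y'∈q
    meets-diagonal (step e@(colE _ dz x<x' _) q) _ a≤x b≤c c<b+p _ | inj₁ above
      with meets-diagonal q dz (≤-trans a≤x (<⇒≤ x<x')) b≤c c<b+p
             (no-jump e a≤x (≤-trans b≤c (sinkColumn≤ q)) above)
    ... | x' , y' , d' , a≤x' , onDiagonal , x'y'∈q = x' , y' , d' , a≤x' , onDiagonal , there x'y'∈q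
    meets-diagonal (step e@(snkE _ _) here) _ a≤x b≤c c<b+p _ | inj₁ above =
      ⊥-elim (no-exit e a≤x b≤c c<b+p above)

Cyc-unwrapped : ∀ {k n d} → d + k ≤ n → ∀ x → Cyc k n (suc d) x ⇔ (d < x × x ≤ d + k)
Cyc-unwrapped {k} {n} {d} d+k≤n x = mk⇔ to from
  where
  to : Cyc k n (suc d) x → d < x × x ≤ d + k
  to (_ , j , j<k , inj₁ refl) =
    s≤s (m≤m+n d j) , ≤-by-certificate 0 j<k (solve (d ∷ j ∷ k ∷ []))
  to ((1≤x , _) , j , j<k , inj₂ x+n≡i+j) = ⊥-elim (⊥-by-certificate 0
    (+-mono-≤ 1≤x (+-mono-≤ d+k≤n (+-mono-≤ j<k (≤-reflexive x+n≡i+j)))) (solve (x ∷ n ∷ d ∷ j ∷ k ∷ [])))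
  from : d < x × x ≤ d + k → Cyc k n (suc d) x
  from (d<x , x≤d+k) with m≤n⇒∃[o]m+o≡n d<x
  ... | j , refl =
    (s≤s z≤n , ≤-trans x≤d+k d+k≤n) , j , ≤-by-certificate 0 x≤d+k (solve (d ∷ j ∷ k ∷ [])) , inj₁ refl

Cyc-wrapped : ∀ {k m n r} → k + m ≡ n → 1 ≤ r → r ≤ k → ∀ x →
              Cyc k n (m + r) x ⇔ ((m + r ≤ x × x ≤ n) ⊎ (1 ≤ x × x < r))
Cyc-wrapped {k} {m} {n} {r} refl 1≤r r≤k x = mk⇔ to from
  where
  to : Cyc k n (m + r) x → (m + r ≤ x × x ≤ n) ⊎ (1 ≤ x × x < r)
  to ((_ , x≤n) , j , _ , inj₁ refl) = inj₁ (m≤m+n (m + r) j , x≤n)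
  to ((1≤x , _) , j , j<k , inj₂ x+n≡i+j) = inj₂ (1≤x , ≤-by-certificate 0
    (+-mono-≤ (≤-reflexive x+n≡i+j) j<k) (solve (x ∷ k ∷ m ∷ r ∷ j ∷ [])))
  from : (m + r ≤ x × x ≤ n) ⊎ (1 ≤ x × x < r) → Cyc k n (m + r) x
  from (inj₁ (i≤x , x≤n)) with m≤n⇒∃[o]m+o≡n i≤x
  ... | j , refl = (≤-trans (≤-trans 1≤r (m≤n+m r m)) i≤x , x≤n) , j
                 , ≤-by-certificate 0 (+-mono-≤ x≤n 1≤r) (solve (m ∷ r ∷ j ∷ k ∷ [])) , inj₁ refl
  from (inj₂ (1≤x , x<r)) with m≤n⇒∃[o]m+o≡n r≤k
  ... | t , refl = (1≤x , ≤-by-certificate (t + m) (<⇒≤ x<r) (solve (x ∷ r ∷ t ∷ m ∷ [])))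
                 , x + t , ≤-by-certificate 0 x<r (solve (x ∷ t ∷ r ∷ []))
                 , inj₂ (solve (x ∷ r ∷ t ∷ m ∷ []))

sinkLabel-aboveRows : ∀ {S c k e d} → S + c ≡ suc (k + (e + d)) → d < S ⇔ c ≤ k + e
sinkLabel-aboveRows {S} {c} {k} {e} {d} S+c≡ = mk⇔ to from
  where
  to : d < S → c ≤ k + e
  to d<S = ≤-by-certificate 0 (+-mono-≤ d<S (≤-reflexive S+c≡)) (solve (S ∷ c ∷ k ∷ e ∷ d ∷ []))
  from : c ≤ k + e → d < S
  from c≤k+e = ≤-by-certificate 0 (+-mono-≤ c≤k+e (≤-reflexive (sym S+c≡))) (solve (S ∷ c ∷ k ∷ e ∷ d ∷ []))

sinkLabel-belowWindow : ∀ {S c k e d} → S + c ≡ suc (k + (e + d)) → S ≤ d + k ⇔ e < c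
sinkLabel-belowWindow {S} {c} {k} {e} {d} S+c≡ = mk⇔ to from
  where
  to : S ≤ d + k → e < c
  to S≤d+k = ≤-by-certificate 0 (+-mono-≤ S≤d+k (≤-reflexive (sym S+c≡))) (solve (S ∷ c ∷ k ∷ e ∷ d ∷ []))
  from : e < c → S ≤ d + k
  from e<c = ≤-by-certificate 0 (+-mono-≤ e<c (≤-reflexive S+c≡)) (solve (S ∷ c ∷ k ∷ e ∷ d ∷ []))

sinkLabel>rows : ∀ {S c k m} → S + c ≡ suc (k + m) → c ≤ m → k < S
sinkLabel>rows {S} {c} {k} {m} S+c≡ c≤m =
  ≤-by-certificate 0 (+-mono-≤ c≤m (≤-reflexive (sym S+c≡))) (solve (S ∷ c ∷ k ∷ m ∷ []))

sinkLabel≤ : ∀ {S c n} → S + c ≡ suc n → 1 ≤ c → S ≤ n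
sinkLabel≤ {S} {c} {n} S+c≡ 1≤c = ≤-by-certificate 0 (+-mono-≤ 1≤c (≤-reflexive S+c≡)) (solve (S ∷ c ∷ n ∷ []))

sinkLabel-wrapped⇔ : ∀ {S c k m r} → S + c ≡ suc (k + m) → m + r ≤ S ⇔ r + c ≤ suc k
sinkLabel-wrapped⇔ {S} {c} {k} {m} {r} S+c≡ = mk⇔ to from
  where
  to : m + r ≤ S → r + c ≤ suc k
  to m+r≤S = ≤-by-certificate 0 (+-mono-≤ m+r≤S (≤-reflexive S+c≡)) (solve (S ∷ c ∷ k ∷ m ∷ r ∷ []))
  from : r + c ≤ suc k → m + r ≤ S
  from r+c≤1+k = ≤-by-certificate 0 (+-mono-≤ r+c≤1+k (≤-reflexive (sym S+c≡))) (solve (S ∷ c ∷ k ∷ m ∷ r ∷ []))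

topRowCell-number : ∀ e d → 1 ≤ d → e + d ∸ suc e + 2 ≡ suc d
topRowCell-number e (suc d) _ = begin
  e + suc d ∸ suc e + 2 ≡⟨ cong (λ t → t ∸ suc e + 2) (+-suc e d) ⟩
  e + d ∸ e + 2         ≡⟨ cong (_+ 2) (m+n∸m≡n e d) ⟩
  d + 2                 ≡⟨ +-comm d 2 ⟩
  suc (suc d)           ∎
  where open ≡-Reasoning

module Dkn-Positroid (k n : ℕ) (A : ℕ → Bool) (2≤k : 2 ≤ k) (k+2≤n : k + 2 ≤ n) where

  m : ℕ
  m = n ∸ k

  D : Filling
  D = Dkn k n A

  open PathsIn D

  k+m≡n : k + m ≡ n
  k+m≡n = m+[n∸m]≡n (≤-trans (m≤m+n k 2) k+2≤n)

  2≤m : 2 ≤ m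
  2≤m = subst (_≤ m) (m+n∸m≡n k 2) (∸-monoˡ-≤ k k+2≤n)

  1≤k : 1 ≤ k
  1≤k = <⇒≤ 2≤k

  1≤m : 1 ≤ m
  1≤m = <⇒≤ 2≤m

  CornerCut : Set
  CornerCut = A 1 ≡ true

  cornerCut? : Dec CornerCut
  cornerCut? = A 1 Bool.≟ true

  len-ordinary : ∀ x → ¬ (x ≡ k × CornerCut) → len D x ≡ m
  len-ordinary x ordinary with x ≡ᵇ k in x≡ᵇk | A 1
  ... | false | _ = refl
  ... | true | false = refl
  ... | true | true = ⊥-elim (ordinary (≡ᵇ⇒≡′ x≡ᵇk , refl))

  len-cut : CornerCut → len D k ≡ m ∸ 1
  len-cut cut rewrite ≡ᵇ-refl k | cut = refl

  len-cases : ∀ x → len D x ≡ m ⊎ (x ≡ k × CornerCut × len D x ≡ m ∸ 1)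
  len-cases x with x ≟ k | cornerCut?
  ... | yes x≡k | yes cut = inj₂ (x≡k , cut , subst (λ z → len D z ≡ m ∸ 1) (sym x≡k) (len-cut cut))
  ... | no x≢k | _ = inj₁ (len-ordinary x (x≢k ∘ proj₁))
  ... | yes _ | no ¬cut = inj₁ (len-ordinary x (¬cut ∘ proj₂))

  m∸1<m : m ∸ 1 < m
  m∸1<m = ∸-monoʳ-< (s≤s z≤n) 1≤m

  <m⇒≤m∸1 : ∀ {y} → y < m → y ≤ m ∸ 1
  <m⇒≤m∸1 {y} y<m = subst (y ≤_) (pred[m∸n]≡m∸[1+n] m 0) (<⇒≤pred y<m)

  len≤m : ∀ x → len D x ≤ m
  len≤m x with len-cases x
  ... | inj₁ len≡m = ≤-reflexive len≡m
  ... | inj₂ (_ , _ , len≡m∸1) = subst (_≤ m) (sym len≡m∸1) (m∸n≤m m 1)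

  dot-inBox : ∀ {x y} → IsDot D x y → (1 ≤ x × x ≤ k) × (1 ≤ y × y ≤ m)
  dot-inBox {x} (x-bounds , (1≤y , y≤len) , _) = x-bounds , 1≤y , ≤-trans y≤len (len≤m x)

  interiorDot : ∀ {x y} → 2 ≤ x → x ≤ k → 2 ≤ y → y ≤ len D x → IsDot D x y
  interiorDot {x} {y} 2≤x x≤k 2≤y y≤len = (<⇒≤ 2≤x , x≤k) , (<⇒≤ 2≤y , y≤len) , dot≡true
    where
    dot≡true : dot D x y ≡ true
    dot≡true rewrite ≢⇒≡ᵇ-false (>⇒≢ 2≤x) | ≢⇒≡ᵇ-false (>⇒≢ 2≤y)
      with x ≡ᵇ k | y ≡ᵇ m in y≡ᵇm | A 1
    ... | true | true | true = ⊥-elim (<⇒≱ m∸1<m (subst (_≤ m ∸ 1) (≡ᵇ⇒≡′ y≡ᵇm) y≤len))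
    ... | true | true | false = refl
    ... | true | false | _ = refl
    ... | false | _ | _ = refl

  1≤len : ∀ x → 1 ≤ len D x
  1≤len x with len-cases x
  ... | inj₁ len≡m = subst (1 ≤_) (sym len≡m) 1≤m
  ... | inj₂ (_ , _ , len≡m∸1) = subst (1 ≤_) (sym len≡m∸1) (∸-monoˡ-≤ 1 2≤m)

  topRowDot⇔ : ∀ {y} → 1 ≤ y → y ≤ m → IsDot D 1 y ⇔ (¬ A (m ∸ y + 2) ≡ true)
  topRowDot⇔ {y} 1≤y y≤m = mk⇔
    (λ (_ , _ , isDot) → Equivalence.to not≡true⇔≢true (trans (sym dot≡) isDot))
    (λ ¬a → (≤-refl , 1≤k) , (1≤y , subst (y ≤_) (sym len≡m) y≤m) ,
            trans dot≡ (Equivalence.from not≡true⇔≢true ¬a))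
    where
    1≢k : 1 ≢ k
    1≢k = <⇒≢ 2≤k
    dot≡ : dot D 1 y ≡ not (A (m ∸ y + 2))
    dot≡ rewrite ≢⇒≡ᵇ-false 1≢k = refl
    len≡m : len D 1 ≡ m
    len≡m = len-ordinary 1 (1≢k ∘ proj₁)

  leftColumnDot⇔ : ∀ {x} → 2 ≤ x → x ≤ k → IsDot D x 1 ⇔ (¬ A (m + x) ≡ true)
  leftColumnDot⇔ {x} 2≤x x≤k = mk⇔
    (λ (_ , _ , isDot) → Equivalence.to not≡true⇔≢true (trans (sym dot≡) isDot))
    (λ ¬a → (<⇒≤ 2≤x , x≤k) , (≤-refl , 1≤len x) , trans dot≡ (Equivalence.from not≡true⇔≢true ¬a))
    where
    dot≡ : dot D x 1 ≡ not (A (m + x))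
    dot≡ rewrite ≢⇒≡ᵇ-false (<⇒≢ 2≤m) | Bool.∧-zeroʳ (x ≡ᵇ k) | ≢⇒≡ᵇ-false (>⇒≢ 2≤x) = refl

  cutCorner-noDot : CornerCut → ¬ IsDot D k m
  cutCorner-noDot cut (_ , (_ , m≤len) , _) = <⇒≱ m∸1<m (subst (m ≤_) (len-cut cut) m≤len)

  nonDot-onBoundary : ∀ {x y} → 1 ≤ x → x ≤ k → 1 ≤ y → ¬ IsDot D x y → x ≡ 1 ⊎ y ≡ 1 ⊎ len D x < y
  nonDot-onBoundary {x} {y} 1≤x x≤k 1≤y ¬dot with x ≟ 1 | y ≟ 1 | y ≤? len D x
  ... | yes x≡1 | _ | _ = inj₁ x≡1
  ... | no _ | yes y≡1 | _ = inj₂ (inj₁ y≡1)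
  ... | no _ | no _ | no y≰len = inj₂ (inj₂ (≰⇒> y≰len))
  ... | no x≢1 | no y≢1 | yes y≤len =
    ⊥-elim (¬dot (interiorDot (≤∧≢⇒< 1≤x (x≢1 ∘ sym)) x≤k (≤∧≢⇒< 1≤y (y≢1 ∘ sym)) y≤len))

  srcLabel-ordinary : ∀ r → ¬ (r ≡ k × CornerCut) → srcLabel D r ≡ r
  srcLabel-ordinary r ordinary rewrite len-ordinary r ordinary | n∸n≡0 m = +-identityʳ r

  srcLabel-cut : CornerCut → srcLabel D k ≡ suc k
  srcLabel-cut cut rewrite len-cut cut | m∸[m∸n]≡n 1≤m = +-comm k 1

  rowsReaching-ordinary : ∀ c → c ≤ m → ¬ (c ≡ m × CornerCut) →
                          length (filter (λ r → c ≤? len D r) (applyUpTo suc k)) ≡ k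
  rowsReaching-ordinary c c≤m ordinary =
    trans (cong length (filter-all (λ r → c ≤? len D r) (All.applyUpTo⁺₁ suc k reaches)))
          (length-applyUpTo suc k)
    where
    reaches : ∀ {j} → j < k → c ≤ len D (suc j)
    reaches {j} _ with len-cases (suc j)
    ... | inj₁ len≡m = subst (c ≤_) (sym len≡m) c≤m
    ... | inj₂ (_ , cut , len≡m∸1) =
      subst (c ≤_) (sym len≡m∸1) (<m⇒≤m∸1 (≤∧≢⇒< c≤m λ c≡m → ordinary (c≡m , cut)))

  rowsReaching-cut : CornerCut → length (filter (λ r → m ≤? len D r) (applyUpTo suc k)) ≡ pred k
  rowsReaching-cut cut = length-filter-applyUpTo-butLast (λ r → m ≤? len D r) k suc reaches lastShort
    where
    reaches : ∀ j → suc j < k → m ≤ len D (suc j)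
    reaches j 1+j<k = ≤-reflexive (sym (len-ordinary (suc j) (<⇒≢ 1+j<k ∘ proj₁)))
    lastShort : ¬ m ≤ len D (suc (pred k))
    lastShort rewrite suc-pred k ⦃ >-nonZero 1≤k ⦄ | len-cut cut = <⇒≱ m∸1<m

  snkLabel-ordinary : ∀ c → c ≤ m → ¬ (c ≡ m × CornerCut) → snkLabel D c + c ≡ suc n
  snkLabel-ordinary c c≤m ordinary = begin
    snkLabel D c + c      ≡⟨ cong (λ t → m ∸ c + t + 1 + c) (rowsReaching-ordinary c c≤m ordinary) ⟩
    m ∸ c + k + 1 + c     ≡⟨ rearrange (m ∸ c) ⟩
    suc (k + (m ∸ c + c)) ≡⟨ cong (λ t → suc (k + t)) (m∸n+n≡m c≤m) ⟩
    suc (k + m)           ≡⟨ cong suc k+m≡n ⟩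
    suc n                 ∎
    where
    open ≡-Reasoning
    rearrange : ∀ t → t + k + 1 + c ≡ suc (k + (t + c))
    rearrange t = solve (t ∷ k ∷ c ∷ [])

  snkLabel-cut : CornerCut → snkLabel D m ≡ k
  snkLabel-cut cut = begin
    m ∸ m + reaching + 1 ≡⟨ cong₂ (λ s t → s + t + 1) (n∸n≡0 m) (rowsReaching-cut cut) ⟩
    pred k + 1           ≡⟨ +-comm (pred k) 1 ⟩
    suc (pred k)         ≡⟨ suc-pred k ⦃ >-nonZero 1≤k ⦄ ⟩
    k                    ∎
    where
    open ≡-Reasoning
    reaching : ℕ
    reaching = length (filter (λ r → m ≤? len D r) (applyUpTo suc k))

  srcLabel-cases : ∀ r → (¬ (r ≡ k × CornerCut) × srcLabel D r ≡ r) ⊎ (r ≡ k × CornerCut × srcLabel D r ≡ suc k)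
  srcLabel-cases r with (r ≟ k) ×-dec cornerCut?
  ... | yes (r≡k , cut) = inj₂ (r≡k , cut , subst (λ z → srcLabel D z ≡ suc k) (sym r≡k) (srcLabel-cut cut))
  ... | no ordinary = inj₁ (ordinary , srcLabel-ordinary r ordinary)

  snkLabel-cases : ∀ c → c ≤ m →
                   (¬ (c ≡ m × CornerCut) × snkLabel D c + c ≡ suc n) ⊎ (c ≡ m × CornerCut × snkLabel D c ≡ k)
  snkLabel-cases c c≤m with (c ≟ m) ×-dec cornerCut?
  ... | yes (c≡m , cut) = inj₂ (c≡m , cut , subst (λ z → snkLabel D z ≡ k) (sym c≡m) (snkLabel-cut cut))
  ... | no ordinary = inj₁ (ordinary , snkLabel-ordinary c c≤m ordinary)

  IsLabel : ℕ → Set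
  IsLabel x = (∃ λ r → (1 ≤ r × r ≤ k) × srcLabel D r ≡ x) ⊎ (∃ λ c → (1 ≤ c × c ≤ m) × snkLabel D c ≡ x)

  label-onto : ∀ x → 1 ≤ x → x ≤ n → IsLabel x
  label-onto x 1≤x x≤n with (x ≟ k) ×-dec cornerCut? | (x ≟ suc k) ×-dec cornerCut? | x ≤? k
  ... | yes (x≡k , cut) | _ | _ = inj₂ (m , (1≤m , ≤-refl) , trans (snkLabel-cut cut) (sym x≡k))
  ... | no _ | yes (x≡1+k , cut) | _ = inj₁ (k , (1≤k , ≤-refl) , trans (srcLabel-cut cut) (sym x≡1+k))
  ... | no ordinary | no _ | yes x≤k = inj₁ (x , (1≤x , x≤k) , srcLabel-ordinary x ordinary)
  ... | no _ | no ordinary | no x≰k with m≤n⇒∃[o]m+o≡n x≤n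
  ...   | t , x+t≡n = inj₂ (suc t , (s≤s z≤n , 1+t≤m) , +-cancelʳ-≡ (suc t) _ _ sinkLabel+c)
    where
    1+t≤m : suc t ≤ m
    1+t≤m = below (≰⇒> x≰k) (trans x+t≡n (sym k+m≡n))
      where
      below : ∀ {x t k m} → k < x → x + t ≡ k + m → suc t ≤ m
      below {x} {t} {k} {m} k<x x+t≡k+m =
        ≤-by-certificate 0 (+-mono-≤ k<x (≤-reflexive x+t≡k+m)) (solve (x ∷ t ∷ k ∷ m ∷ []))
    c≢m∨uncut : ¬ (suc t ≡ m × CornerCut)
    c≢m∨uncut (1+t≡m , cut) = ordinary (+-cancelʳ-≡ m x (suc k) (begin
      x + m               ≡⟨ cong (x +_) 1+t≡m ⟨
      x + suc t           ≡⟨ +-suc x t ⟩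
      suc (x + t)         ≡⟨ cong suc (trans x+t≡n (sym k+m≡n)) ⟩
      suc k + m           ∎) , cut)
      where open ≡-Reasoning
    sinkLabel+c : snkLabel D (suc t) + suc t ≡ x + suc t
    sinkLabel+c =
      trans (snkLabel-ordinary (suc t) 1+t≤m c≢m∨uncut) (trans (cong suc (sym x+t≡n)) (sym (+-suc x t)))

  rightmostDot-atRowEnd : ∀ {r y} → 2 ≤ r → IsDot D r y → (∀ c' → y < c' → ¬ IsDot D r c') → len D r ≤ y
  rightmostDot-atRowEnd {r} {y} 2≤r dy rightmost with y <? len D r
  ... | no y≮len = ≮⇒≥ y≮len
  ... | yes y<len with dot-inBox dy
  ...   | (_ , r≤k) , (1≤y , _) = ⊥-elim (rightmost (suc y) ≤-refl (interiorDot 2≤r r≤k (s≤s 1≤y) y<len))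

  record Exchange (B : ℕ → Set) (a b p : ℕ) : Set where
    field
      sources : ∀ r → 1 ≤ r → r ≤ k → B (srcLabel D r) ⇔ (¬ (a ≤ r × r < a + p))
      sinks   : ∀ c → 1 ≤ c → c ≤ m → B (snkLabel D c) ⇔ (b ≤ c × c < b + p)

  module HookSystem (a b p : ℕ) (1≤a : 1 ≤ a) (a+p≤1+k : a + p ≤ suc k)
                    (diagonal : ∀ t → t < p → IsDot D (a + t) (b + t)) where

    InRows : ℕ → Set
    InRows r = a ≤ r × r < a + p

    inRows? : ∀ r → Dec (InRows r)
    inRows? r = (a ≤? r) ×-dec (r <? a + p)

    column : ℕ → ℕ
    column r = b + (r ∸ a)

    offset<p : ∀ {r} → InRows r → r ∸ a < p
    offset<p {r} (a≤r , r<a+p) = subst (r ∸ a <_) (m+n∸m≡n a p) (∸-monoˡ-< r<a+p a≤r)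

    diagonalDot : ∀ {r} → InRows r → IsDot D r (column r)
    diagonalDot {r} inRows@(a≤r , _) =
      subst (λ x → IsDot D x (column r)) (m+[n∸m]≡n a≤r) (diagonal (r ∸ a) (offset<p inRows))

    endOf : ∀ r → Dec (InRows r) → Vtx
    endOf r (yes _) = snk (column r)
    endOf r (no _) = src r

    Route : ∀ r → Dec (InRows r) → Vtx → Set
    Route r (yes _) = Hook r (column r)
    Route r (no _) v = v ≡ src r

    route : ∀ r (d : Dec (InRows r)) → Σ (Path D (src r) (endOf r d)) λ q → All (Route r d) (verts q)
    route r (yes inRows) = hookPath (diagonalDot inRows)
    route r (no _) = here , refl All.∷ All.[]

    routes-disjoint : ∀ {r r'} → r < r' → (d : Dec (InRows r)) (d' : Dec (InRows r')) →
                      ∀ {v} → Route r d v → Route r' d' v → ⊥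
    routes-disjoint r<r' (no _) (no _) refl refl = <-irrefl refl r<r'
    routes-disjoint r<r' (no _) (yes _) refl onHook = source∉otherHook (<⇒≢ r<r') onHook
    routes-disjoint r<r' (yes _) (no _) onHook refl = source∉otherHook (>⇒≢ r<r') onHook
    routes-disjoint {r} r<r' (yes (a≤r , _)) (yes _) onHook onHook' =
      hooks-disjoint r<r' (+-monoʳ-< b (∸-monoˡ-< r<r' a≤r)) onHook onHook'

    system : PathSystem D
    system = record
      { end = λ r → endOf r (inRows? r)
      ; path = λ r _ _ → proj₁ (route r (inRows? r))
      ; endOK = λ r _ _ → endOK′ r (inRows? r)
      ; disjoint = λ r r' _ _ _ _ r≢r' v v∈p v∈p' →
          disjoint′ r≢r' (inRows? r) (inRows? r')
            (All.lookup (proj₂ (route r (inRows? r))) v∈p)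
            (All.lookup (proj₂ (route r' (inRows? r'))) v∈p')
      }
      where
      endOK′ : ∀ r (d : Dec (InRows r)) → endOf r d ≡ src r ⊎ ∃ λ c → (1 ≤ c × c ≤ m) × endOf r d ≡ snk c
      endOK′ r (yes inRows) = inj₂ (column r , proj₂ (dot-inBox (diagonalDot inRows)) , refl)
      endOK′ r (no _) = inj₁ refl
      disjoint′ : ∀ {r r'} → r ≢ r' → (d : Dec (InRows r)) (d' : Dec (InRows r')) →
                  ∀ {v} → Route r d v → Route r' d' v → ⊥
      disjoint′ {r} {r'} r≢r' d d' onRoute onRoute' with <-cmp r r'
      ... | tri< r<r' _ _ = routes-disjoint r<r' d d' onRoute onRoute'
      ... | tri≈ _ r≡r' _ = r≢r' r≡r'
      ... | tri> _ _ r'<r = routes-disjoint r'<r d' d onRoute' onRoute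

    hooks-realize : ∀ {B} → Exchange B a b p → (∀ x → B x → 1 ≤ x × x ≤ n) → IsBasis D B
    hooks-realize {B} ex B⊆[n] = system , λ x → mk⇔ (realized x) (inB x)
      where
      open Exchange ex
      realized : ∀ x → B x → Realized system x
      realized x Bx with label-onto x (proj₁ (B⊆[n] x Bx)) (proj₂ (B⊆[n] x Bx))
      ... | inj₁ (r , r-bounds@(1≤r , r≤k) , label≡x) = r , r-bounds , trivialRoute (inRows? r)
        where
        trivialRoute : (d : Dec (InRows r)) → label D (endOf r d) ≡ x
        trivialRoute (yes inRows) =
          ⊥-elim (Equivalence.to (sources r 1≤r r≤k) (subst B (sym label≡x) Bx) inRows)
        trivialRoute (no _) = label≡x
      ... | inj₂ (c , (1≤c , c≤m) , label≡x) =
        r , (≤-trans 1≤a (m≤m+n a (c ∸ b)) , r≤k) , hookRoute (inRows? r)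
        where
        b≤c×c<b+p : b ≤ c × c < b + p
        b≤c×c<b+p = Equivalence.to (sinks c 1≤c c≤m) (subst B (sym label≡x) Bx)
        c∸b<p : c ∸ b < p
        c∸b<p = subst (c ∸ b <_) (m+n∸m≡n b p) (∸-monoˡ-< (proj₂ b≤c×c<b+p) (proj₁ b≤c×c<b+p))
        r : ℕ
        r = a + (c ∸ b)
        r≤k : r ≤ k
        r≤k = ≤-pred (≤-trans (+-monoʳ-< a c∸b<p) a+p≤1+k)
        column≡c : column r ≡ c
        column≡c = trans (cong (b +_) (m+n∸m≡n a (c ∸ b))) (m+[n∸m]≡n (proj₁ b≤c×c<b+p))
        hookRoute : (d : Dec (InRows r)) → label D (endOf r d) ≡ x
        hookRoute (yes _) = trans (cong (snkLabel D) column≡c) label≡x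
        hookRoute (no ¬inRows) = ⊥-elim (¬inRows (m≤m+n a (c ∸ b) , +-monoʳ-< a c∸b<p))
      inB : ∀ x → Realized system x → B x
      inB x (r , (1≤r , r≤k) , label≡x) = endpointInB (inRows? r) label≡x
        where
        endpointInB : (d : Dec (InRows r)) → label D (endOf r d) ≡ x → B x
        endpointInB (yes inRows) label≡x = subst B label≡x (Equivalence.from (sinks (column r) 1≤c c≤m)
          (m≤m+n b (r ∸ a) , +-monoʳ-< b (offset<p inRows)))
          where
          1≤c = proj₁ (proj₂ (dot-inBox (diagonalDot inRows)))
          c≤m = proj₂ (proj₂ (dot-inBox (diagonalDot inRows)))
        endpointInB (no ¬inRows) label≡x =
          subst B label≡x (Equivalence.from (sources r 1≤r r≤k) ¬inRows)

  record Block : Set where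
    field
      a b p : ℕ
      1≤a : 1 ≤ a
      1≤b : 1 ≤ b
      1≤p : 1 ≤ p
      rows-fit : a + p ≤ suc k
      columns-fit : b + p ≤ suc m
      avoids-cut : CornerCut → a + p ≤ k ⊎ b + p ≤ m
      -- the cell (a + p, b + p) lies outside the shape
      maximal : a + p ≡ suc k ⊎ b + p ≡ suc m ⊎ (CornerCut × a + p ≡ k × b + p ≡ m)

  module BlockDiagonal (β : Block) where
    open Block β

    row≤k : ∀ {t} → t < p → a + t ≤ k
    row≤k t<p = ≤-pred (≤-trans (+-monoʳ-< a t<p) rows-fit)

    diagonal-inShape : ∀ t → t < p → b + t ≤ len D (a + t)
    diagonal-inShape t t<p with len-cases (a + t)
    ... | inj₁ len≡m = subst (b + t ≤_) (sym len≡m) (≤-pred (≤-trans (+-monoʳ-< b t<p) columns-fit))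
    ... | inj₂ (a+t≡k , cut , len≡m∸1) with avoids-cut cut
    ...   | inj₁ a+p≤k = ⊥-elim (<⇒≱ (+-monoʳ-< a t<p) (subst (a + p ≤_) (sym a+t≡k) a+p≤k))
    ...   | inj₂ b+p≤m = subst (b + t ≤_) (sym len≡m∸1) (<m⇒≤m∸1 (<-≤-trans (+-monoʳ-< b t<p) b+p≤m))

    diagonal-dots : IsDot D a b → ∀ t → t < p → IsDot D (a + t) (b + t)
    diagonal-dots dab zero _ = subst₂ (IsDot D) (sym (+-identityʳ a)) (sym (+-identityʳ b)) dab
    diagonal-dots _ (suc t) t<p = interiorDot (+-mono-≤ 1≤a (s≤s z≤n)) (row≤k t<p) (+-mono-≤ 1≤b (s≤s z≤n))
                                    (diagonal-inShape (suc t) t<p)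

    diagonal-bounded : ∀ {s} → IsDot D (a + s) (b + s) → s < p
    diagonal-bounded {s} dot with p ≤? s
    ... | no p≰s = ≰⇒> p≰s
    ... | yes p≤s with dot-inBox dot | maximal
    ...   | (_ , a+s≤k) , _ | inj₁ a+p≡1+k =
      ⊥-elim (<⇒≱ (subst (_≤ a + s) a+p≡1+k (+-monoʳ-≤ a p≤s)) a+s≤k)
    ...   | _ , (_ , b+s≤m) | inj₂ (inj₁ b+p≡1+m) =
      ⊥-elim (<⇒≱ (subst (_≤ b + s) b+p≡1+m (+-monoʳ-≤ b p≤s)) b+s≤m)
    ...   | (_ , a+s≤k) , _ | inj₂ (inj₂ (cut , a+p≡k , b+p≡m)) =
      ⊥-elim (cutCorner-noDot cut cornerDot)
      where
      s≡p : s ≡ p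
      s≡p = ≤-antisym (+-cancelˡ-≤ a s p (subst (a + s ≤_) (sym a+p≡k) a+s≤k)) p≤s
      cornerDot : IsDot D k m
      cornerDot = subst₂ (IsDot D) (trans (cong (a +_) s≡p) a+p≡k) (trans (cong (b +_) s≡p) b+p≡m) dot

    row1-weaklyAbove : ∀ {y} → b ≤ y → 1 + b ≤ y + a
    row1-weaklyAbove b≤y = subst (1 + b ≤_) (+-comm a _) (+-mono-≤ 1≤a b≤y)

    column1-notAbove : ∀ {x} → a ≤ x → ¬ (x + b < 1 + a)
    column1-notAbove {x} a≤x above = <⇒≱ above (subst (_≤ x + b) (+-comm a 1) (+-mono-≤ a≤x 1≤b))

    strictlyAbove-farFromEnd : ∀ {x y} → x + b < y + a → y < b + p → suc (suc x) ≤ a + p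
    strictlyAbove-farFromEnd = certificate
      where
      certificate : ∀ {x y a b p} → x + b < y + a → y < b + p → suc (suc x) ≤ a + p
      certificate {x} {y} {a} {b} {p} above y<b+p =
        ≤-by-certificate 0 (+-mono-≤ above y<b+p) (solve (x ∷ y ∷ a ∷ b ∷ p ∷ []))

    no-jump : ∀ {x y x' y'} → Edge D (dt x y) (dt x' y') → a ≤ x → b ≤ y' → x + b < y + a → x' + b ≤ y' + a
    no-jump (rowE {r = x} {c = y} {c' = y'} dx dy' y'<y gap) a≤x b≤y' above with m≤n⇒m<n∨m≡n y'<y
    ... | inj₂ refl = ≤-pred above
    ... | inj₁ 1+y'<y with dot-inBox dx | dot-inBox dy'
    ...   | (1≤x , x≤k) , _ | _ , (1≤y' , _)
      with nonDot-onBoundary 1≤x x≤k (s≤s z≤n) (gap (suc y') ≤-refl 1+y'<y)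
    ...     | inj₁ refl = row1-weaklyAbove b≤y'
    ...     | inj₂ (inj₁ refl) = ⊥-elim (<-irrefl refl 1≤y')
    ...     | inj₂ (inj₂ len<1+y') = ⊥-elim (<⇒≱ (<-trans len<1+y' 1+y'<y) (column≤len dx))
    no-jump (colE {r = x} {r' = x'} {c = y} dx dx' x<x' gap) a≤x b≤y above with m≤n⇒m<n∨m≡n x<x'
    ... | inj₂ refl = above
    ... | inj₁ 1+x<x' with dot-inBox dx | dot-inBox dx'
    ...   | (1≤x , _) , (1≤y , y≤m) | (_ , x'≤k) , _
      with nonDot-onBoundary (s≤s z≤n) (≤-trans (<⇒≤ 1+x<x') x'≤k) 1≤y (gap (suc x) ≤-refl 1+x<x')
    ...     | inj₁ 1+x≡1 = ⊥-elim (>⇒≢ (s≤s 1≤x) 1+x≡1)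
    ...     | inj₂ (inj₁ refl) = ⊥-elim (column1-notAbove a≤x above)
    ...     | inj₂ (inj₂ len<y) = ⊥-elim (<⇒≱ len<y (subst (y ≤_) (sym len≡m) y≤m))
      where
      len≡m : len D (suc x) ≡ m
      len≡m = len-ordinary (suc x) (<⇒≢ (<-≤-trans 1+x<x' x'≤k) ∘ proj₁)

    no-exit : ∀ {x y} → Edge D (dt x y) (snk y) → a ≤ x → b ≤ y → y < b + p → x + b < y + a → ⊥
    no-exit (snkE {r = x} {c = y} dx lowest) a≤x b≤y y<b+p above with y ≟ 1 | suc x ≤? k
    ... | yes refl | _ = column1-notAbove a≤x above
    ... | no _ | no 1+x≰k =
      <⇒≱ (strictlyAbove-farFromEnd above y<b+p) (≤-trans rows-fit (s≤s (≤-pred (≰⇒> 1+x≰k))))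
    ... | no y≢1 | yes 1+x≤k
      with nonDot-onBoundary (s≤s z≤n) 1+x≤k (proj₁ (proj₂ (dot-inBox dx))) (lowest (suc x) ≤-refl)
    ...   | inj₁ 1+x≡1 = >⇒≢ (s≤s (proj₁ (proj₁ (dot-inBox dx)))) 1+x≡1
    ...   | inj₂ (inj₁ y≡1) = y≢1 y≡1
    ...   | inj₂ (inj₂ len<y) with len-cases (suc x)
    ...     | inj₁ len≡m = <⇒≱ len<y (subst (y ≤_) (sym len≡m) (proj₂ (proj₂ (dot-inBox dx))))
    ...     | inj₂ (1+x≡k , cut , len≡m∸1) with avoids-cut cut
    ...       | inj₁ a+p≤k =
      <⇒≱ (strictlyAbove-farFromEnd above y<b+p) (subst (a + p ≤_) (sym 1+x≡k) a+p≤k)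
    ...       | inj₂ b+p≤m = <⇒≱ len<y (subst (y ≤_) (sym len≡m∸1) (<m⇒≤m∸1 (<-≤-trans y<b+p b+p≤m)))

    weaklyAbove-fromRowEnd : ∀ {r y M} → r < a + p → b + p ≤ M → M ≤ suc y → r + b ≤ y + a
    weaklyAbove-fromRowEnd = certificate
      where
      certificate : ∀ {r y M a b p} → suc r ≤ a + p → b + p ≤ M → M ≤ suc y → r + b ≤ y + a
      certificate {r} {y} {M} {a} {b} {p} h₁ h₂ h₃ =
        ≤-by-certificate 0 (+-mono-≤ h₁ (+-mono-≤ h₂ h₃)) (solve (r ∷ a ∷ p ∷ b ∷ M ∷ y ∷ []))

    rightmost-weaklyAbove : ∀ {r y} → IsDot D r y → (∀ c' → y < c' → ¬ IsDot D r c') →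
                            a ≤ r → r < a + p → b ≤ y → r + b ≤ y + a
    rightmost-weaklyAbove {r} {y} dy rightmost a≤r r<a+p b≤y with m≤n⇒m<n∨m≡n a≤r
    ... | inj₂ refl = subst (r + b ≤_) (+-comm r y) (+-monoʳ-≤ r b≤y)
    ... | inj₁ a<r with len-cases r | rightmostDot-atRowEnd (≤-trans (s≤s 1≤a) a<r) dy rightmost
    ...   | inj₁ len≡m | len≤y = weaklyAbove-fromRowEnd r<a+p columns-fit (s≤s (subst (_≤ y) len≡m len≤y))
    ...   | inj₂ (r≡k , cut , len≡m∸1) | len≤y with avoids-cut cut
    ...     | inj₁ a+p≤k = ⊥-elim (<⇒≱ r<a+p (subst (a + p ≤_) (sym r≡k) a+p≤k))
    ...     | inj₂ b+p≤m =
      weaklyAbove-fromRowEnd r<a+p b+p≤m (≤-trans (m≤n+m∸n m 1) (s≤s (subst (_≤ y) len≡m∸1 len≤y)))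

    diagonal-column : ∀ s {y} → a + s + b ≡ y + a → y ≡ b + s
    diagonal-column s {y} onDiagonal = +-cancelʳ-≡ a y (b + s) (trans (sym onDiagonal) (swap a s b))
      where
      swap : ∀ a s b → a + s + b ≡ b + s + a
      swap a s b = solve (a ∷ s ∷ b ∷ [])

    open DiagonalCrossing a b p no-jump no-exit

    crossing : ¬ IsDot D a b → ∀ {r v c} → a ≤ r → r < a + p → b ≤ c → c < b + p →
               (q : Path D (src r) v) → v ≡ snk c → Σ ℕ λ s → 1 ≤ s × s < p × dt (a + s) (b + s) ∈ verts q
    crossing ¬corner a≤r r<a+p b≤c c<b+p (step (srcE dy rightmost) q) refl
      with meets-diagonal q dy a≤r b≤c c<b+p
             (rightmost-weaklyAbove dy rightmost a≤r r<a+p (≤-trans b≤c (sinkColumn≤ q)))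
    ... | x' , y' , dx'y' , a≤x' , onDiagonal , x'y'∈q with m≤n⇒∃[o]m+o≡n a≤x'
    ...   | zero , refl =
      ⊥-elim (¬corner (subst₂ (IsDot D) (+-identityʳ a) (trans (diagonal-column 0 onDiagonal) (+-identityʳ b)) dx'y'))
    ...   | suc s , refl =
      suc s , s≤s z≤n , diagonal-bounded (subst (IsDot D (a + suc s)) y'≡b+s dx'y') ,
      subst (λ w → dt (a + suc s) w ∈ verts (step (srcE dy rightmost) q)) y'≡b+s (there x'y'∈q)
      where
      y'≡b+s : y' ≡ b + suc s
      y'≡b+s = diagonal-column (suc s) onDiagonal

    blocked : ¬ IsDot D a b → ∀ {B} → Exchange B a b p → ¬ IsBasis D B
    blocked ¬corner {B} ex (P , realizes) = twoPathsMeet (pigeonhole (∸-monoʳ-< (s≤s z≤n) 1≤p) level)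
      where
      open Exchange ex
      row : Fin p → ℕ
      row j = a + toℕ j
      inRows : ∀ j → a ≤ row j × row j < a + p
      inRows j = m≤m+n a (toℕ j) , +-monoʳ-< a (toℕ<n j)
      1≤row : ∀ j → 1 ≤ row j
      1≤row j = ≤-trans 1≤a (m≤m+n a (toℕ j))
      row≤k′ : ∀ j → row j ≤ k
      row≤k′ j = row≤k (toℕ<n j)
      pathOf : (j : Fin p) → Path D (src (row j)) (end P (row j))
      pathOf j = path P (row j) (1≤row j) (row≤k′ j)
      endInB : ∀ j → B (label D (end P (row j)))
      endInB j = Equivalence.from (realizes _) (row j , (1≤row j , row≤k′ j) , refl)
      endsInWindow : ∀ j → ∃ λ c → (b ≤ c × c < b + p) × end P (row j) ≡ snk c
      endsInWindow j with endOK P (row j) (1≤row j) (row≤k′ j)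
      ... | inj₁ trivial = ⊥-elim (Equivalence.to (sources (row j) (1≤row j) (row≤k′ j))
                                    (subst B (cong (label D) trivial) (endInB j)) (inRows j))
      ... | inj₂ (c , (1≤c , c≤m) , atSink) =
        c , Equivalence.to (sinks c 1≤c c≤m) (subst B (cong (label D) atSink) (endInB j)) , atSink
      meeting : ∀ j → Σ ℕ λ s → 1 ≤ s × s < p × dt (a + s) (b + s) ∈ verts (pathOf j)
      meeting j = let (c , (b≤c , c<b+p) , atSink) = endsInWindow j
                  in crossing ¬corner (proj₁ (inRows j)) (proj₂ (inRows j)) b≤c c<b+p (pathOf j) atSink
      level : Fin p → Fin (p ∸ 1)
      level j = let (s , 1≤s , s<p , _) = meeting j in fromℕ< (∸-monoˡ-< s<p 1≤s)
      twoPathsMeet : (∃₂ λ i j → toℕ i < toℕ j × level i ≡ level j) → ⊥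
      twoPathsMeet (i , j , i<j , level≡) =
        disjoint P (row i) (row j) (1≤row i) (row≤k′ i) (1≤row j) (row≤k′ j) (<⇒≢ (+-monoʳ-< a i<j)) _
          (proj₂ (proj₂ (proj₂ (meeting i))))
          (subst (λ s → dt (a + s) (b + s) ∈ verts (pathOf j)) (sym sᵢ≡sⱼ)
                 (proj₂ (proj₂ (proj₂ (meeting j)))))
        where
        sᵢ≡sⱼ : proj₁ (meeting i) ≡ proj₁ (meeting j)
        sᵢ≡sⱼ = ∸-cancelʳ-≡ (proj₁ (proj₂ (meeting i))) (proj₁ (proj₂ (meeting j)))
                  (trans (sym (toℕ-fromℕ< _)) (trans (cong toℕ level≡) (toℕ-fromℕ< _)))

  block-basis⇔ : ∀ {i} (β : Block) → let open Block β in
                 Exchange (Cyc k n i) a b p → IsDot D a b ⇔ (¬ A i ≡ true) →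
                 IsBasis D (Cyc k n i) ⇔ (¬ A i ≡ true)
  block-basis⇔ β ex corner⇔ = mk⇔
    (λ basis Ai → blocked (λ corner → Equivalence.to corner⇔ corner Ai) ex basis)
    (λ ¬Ai → HookSystem.hooks-realize a b p 1≤a rows-fit (diagonal-dots (Equivalence.from corner⇔ ¬Ai))
                                      ex (λ _ → proj₁))
    where
    open Block β
    open BlockDiagonal β

  k≤n : k ≤ n
  k≤n = ≤-trans (m≤m+n k m) (≤-reflexive k+m≡n)

  module TopRow (d : ℕ) (1≤d : 1 ≤ d) (d≤m : d ≤ m) where
    e : ℕ
    e = m ∸ d

    e+d≡m : e + d ≡ m
    e+d≡m = m∸n+n≡m d≤m

    1+e≤m : suc e ≤ m
    1+e≤m = subst (suc e ≤_) e+d≡m (subst (_≤ e + d) (+-comm e 1) (+-monoʳ-≤ e 1≤d))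

    d+k≤n : d + k ≤ n
    d+k≤n = subst (d + k ≤_) (trans (+-comm m k) k+m≡n) (+-monoˡ-≤ k d≤m)

    cell⇔ : IsDot D 1 (suc e) ⇔ (¬ A (suc d) ≡ true)
    cell⇔ = subst (λ i → IsDot D 1 (suc e) ⇔ (¬ A i ≡ true))
                  (subst (λ z → z ∸ suc e + 2 ≡ suc d) e+d≡m (topRowCell-number e d 1≤d))
                  (topRowDot⇔ (s≤s z≤n) 1+e≤m)

    module _ (p : ℕ)
      (ordinaryRows : ∀ r → r ≤ k → ¬ (r ≡ k × CornerCut) → d < r ⇔ p < r)
      (cutRow : CornerCut → d ≤ k ⇔ p < k)
      (ordinaryColumns : ∀ c → e < c → c ≤ m → ¬ (c ≡ m × CornerCut) → c ≤ k + e ⇔ c ≤ e + p)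
      (cutColumn : CornerCut → d < k ⇔ d ≤ p) where
      open Equivalence

      exchange : Exchange (Cyc k n (suc d)) 1 (suc e) p
      exchange = record { sources = sources ; sinks = sinks }
        where
        window = Cyc-unwrapped d+k≤n
        sources : ∀ r → 1 ≤ r → r ≤ k → Cyc k n (suc d) (srcLabel D r) ⇔ (¬ (1 ≤ r × r < 1 + p))
        sources r 1≤r r≤k with srcLabel-cases r
        ... | inj₁ (ordinary , label≡r) rewrite label≡r = mk⇔
          (λ cyc → from (outsideWindow⇔ 1≤r) (to (ordinaryRows r r≤k ordinary) (proj₁ (to (window r) cyc))))
          (λ outside → from (window r) (from (ordinaryRows r r≤k ordinary) (to (outsideWindow⇔ 1≤r) outside) ,
                                        ≤-trans r≤k (m≤n+m k d)))
        ... | inj₂ (r≡k , cut , label≡1+k) rewrite label≡1+k | r≡k = mk⇔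
          (λ cyc → from (outsideWindow⇔ 1≤k) (to (cutRow cut) (≤-pred (proj₁ (to (window (suc k)) cyc)))))
          (λ outside → from (window (suc k)) (s≤s (from (cutRow cut) (to (outsideWindow⇔ 1≤k) outside)) ,
                                               +-monoˡ-≤ k 1≤d))
        sinks : ∀ c → 1 ≤ c → c ≤ m → Cyc k n (suc d) (snkLabel D c) ⇔ (suc e ≤ c × c < suc e + p)
        sinks c 1≤c c≤m with snkLabel-cases c c≤m
        ... | inj₁ (ordinary , S+c≡1+n) = mk⇔
          (λ cyc → let (d<S , S≤d+k) = to (window _) cyc
                       e<c = to belowWindow S≤d+k
                   in e<c , s≤s (to (ordinaryColumns c e<c c≤m ordinary) (to aboveRows d<S)))
          (λ (e<c , c<1+e+p) → from (window _)
            (from aboveRows (from (ordinaryColumns c e<c c≤m ordinary) (≤-pred c<1+e+p)) , from belowWindow e<c))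
          where
          S+c≡ : snkLabel D c + c ≡ suc (k + (e + d))
          S+c≡ = trans S+c≡1+n (cong suc (trans (sym k+m≡n) (cong (k +_) (sym e+d≡m))))
          aboveRows : d < snkLabel D c ⇔ c ≤ k + e
          aboveRows = sinkLabel-aboveRows {k = k} {e = e} {d = d} S+c≡
          belowWindow : snkLabel D c ≤ d + k ⇔ e < c
          belowWindow = sinkLabel-belowWindow {k = k} {e = e} {d = d} S+c≡
        ... | inj₂ (c≡m , cut , label≡k) rewrite label≡k | c≡m = mk⇔
          (λ cyc → 1+e≤m ,
                   s≤s (subst (_≤ e + p) e+d≡m (+-monoʳ-≤ e (to (cutColumn cut) (proj₁ (to (window k) cyc))))))
          (λ (_ , m<1+e+p) → from (window k)
            (from (cutColumn cut) (+-cancelˡ-≤ e d p (subst (_≤ e + p) (sym e+d≡m) (≤-pred m<1+e+p))) ,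
             m≤n+m k d))

      sizedBlock-basis⇔ : 1 ≤ p → p ≤ k → suc e + p ≤ suc m → (CornerCut → suc p ≤ k ⊎ suc e + p ≤ m) →
                          suc p ≡ suc k ⊎ suc e + p ≡ suc m ⊎ (CornerCut × suc p ≡ k × suc e + p ≡ m) →
                          IsBasis D (Cyc k n (suc d)) ⇔ (¬ A (suc d) ≡ true)
      sizedBlock-basis⇔ 1≤p p≤k columns-fit avoids-cut maximal = block-basis⇔ β exchange cell⇔
        where
        β : Block
        β = record { a = 1 ; b = suc e ; p = p ; 1≤a = ≤-refl ; 1≤b = s≤s z≤n ; 1≤p = 1≤p
                   ; rows-fit = s≤s p≤k ; columns-fit = columns-fit
                   ; avoids-cut = avoids-cut ; maximal = maximal }

    diagonalToRightSide : d ≤ k → (CornerCut → d < k) → IsBasis D (Cyc k n (suc d)) ⇔ (¬ A (suc d) ≡ true)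
    diagonalToRightSide d≤k d<k-ifCut =
      sizedBlock-basis⇔ d (λ _ _ _ → mk⇔ id id) cutRow ordinaryColumns cutColumn
      1≤d d≤k (≤-reflexive (cong suc e+d≡m)) (inj₁ ∘ d<k-ifCut) (inj₂ (inj₁ (cong suc e+d≡m)))
      where
      cutRow : CornerCut → d ≤ k ⇔ d < k
      cutRow cut = both-true⇔ d≤k (d<k-ifCut cut)
      ordinaryColumns : ∀ c → e < c → c ≤ m → ¬ (c ≡ m × CornerCut) → c ≤ k + e ⇔ c ≤ e + d
      ordinaryColumns c _ c≤m _ = both-true⇔
        (≤-trans c≤m (subst (_≤ k + e) e+d≡m (subst (e + d ≤_) (+-comm e k) (+-monoʳ-≤ e d≤k))))
        (subst (c ≤_) (sym e+d≡m) c≤m)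
      cutColumn : CornerCut → d < k ⇔ d ≤ d
      cutColumn cut = both-true⇔ (d<k-ifCut cut) ≤-refl

    diagonalToCut : d ≡ k → CornerCut → IsBasis D (Cyc k n (suc d)) ⇔ (¬ A (suc d) ≡ true)
    diagonalToCut d≡k cut = sizedBlock-basis⇔ (pred k) ordinaryRows cutRow ordinaryColumns cutColumn
      (<⇒≤pred 2≤k) (≤-trans (n≤1+n (pred k)) (≤-reflexive 1+[k-1]≡k))
      (≤-trans (≤-reflexive (sym m≡1+e+[k-1])) (n≤1+n m))
      (λ _ → inj₁ (≤-reflexive 1+[k-1]≡k)) (inj₂ (inj₂ (cut , 1+[k-1]≡k , sym m≡1+e+[k-1])))
      where
      1+[k-1]≡k : suc (pred k) ≡ k
      1+[k-1]≡k = suc-pred k ⦃ >-nonZero 1≤k ⦄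
      k-1<k : pred k < k
      k-1<k = subst (pred k <_) 1+[k-1]≡k ≤-refl
      m≡1+e+[k-1] : m ≡ suc e + pred k
      m≡1+e+[k-1] = begin
        m                ≡⟨ e+d≡m ⟨
        e + d            ≡⟨ cong (e +_) (trans d≡k (sym 1+[k-1]≡k)) ⟩
        e + suc (pred k) ≡⟨ +-suc e (pred k) ⟩
        suc e + pred k   ∎
        where open ≡-Reasoning
      ordinaryRows : ∀ r → r ≤ k → ¬ (r ≡ k × CornerCut) → d < r ⇔ pred k < r
      ordinaryRows r r≤k ordinary = both-false⇔
        (λ d<r → <⇒≱ d<r (subst (r ≤_) (sym d≡k) r≤k))
        (λ k-1<r → ordinary (≤-antisym r≤k (subst (_≤ r) 1+[k-1]≡k k-1<r) , cut))
      cutRow : CornerCut → d ≤ k ⇔ pred k < k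
      cutRow _ = both-true⇔ (≤-reflexive d≡k) k-1<k
      ordinaryColumns : ∀ c → e < c → c ≤ m → ¬ (c ≡ m × CornerCut) → c ≤ k + e ⇔ c ≤ e + pred k
      ordinaryColumns c _ c≤m ordinary = both-true⇔
        (subst (c ≤_) (trans (sym e+d≡m) (trans (cong (e +_) d≡k) (+-comm e k))) c≤m)
        (≤-pred (subst (c <_) m≡1+e+[k-1] (≤∧≢⇒< c≤m λ c≡m → ordinary (c≡m , cut))))
      cutColumn : CornerCut → d < k ⇔ d ≤ pred k
      cutColumn _ = both-false⇔ (<-irrefl d≡k) (λ d≤k-1 → <⇒≱ k-1<k (subst (_≤ pred k) d≡k d≤k-1))

    diagonalToBottom : k < d → IsBasis D (Cyc k n (suc d)) ⇔ (¬ A (suc d) ≡ true)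
    diagonalToBottom k<d = sizedBlock-basis⇔ k ordinaryRows cutRow ordinaryColumns cutColumn
      1≤k ≤-refl (m≤n⇒m≤1+n 1+e+k≤m) (λ _ → inj₂ 1+e+k≤m) (inj₁ refl)
      where
      1+e+k≤m : suc e + k ≤ m
      1+e+k≤m = subst (_≤ m) (+-suc e k) (subst (e + suc k ≤_) e+d≡m (+-monoʳ-≤ e k<d))
      ordinaryRows : ∀ r → r ≤ k → ¬ (r ≡ k × CornerCut) → d < r ⇔ k < r
      ordinaryRows r r≤k _ = both-false⇔ (λ d<r → <⇒≱ (<-trans k<d d<r) r≤k) (λ k<r → <⇒≱ k<r r≤k)
      cutRow : CornerCut → d ≤ k ⇔ k < k
      cutRow _ = both-false⇔ (<⇒≱ k<d) (<-irrefl refl)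
      ordinaryColumns : ∀ c → e < c → c ≤ m → ¬ (c ≡ m × CornerCut) → c ≤ k + e ⇔ c ≤ e + k
      ordinaryColumns c _ _ _ = mk⇔ (subst (c ≤_) (+-comm k e)) (subst (c ≤_) (+-comm e k))
      cutColumn : CornerCut → d < k ⇔ d ≤ k
      cutColumn _ = both-false⇔ (λ d<k → <-asym d<k k<d) (<⇒≱ k<d)

    topRow-basis⇔ : IsBasis D (Cyc k n (suc d)) ⇔ (¬ A (suc d) ≡ true)
    topRow-basis⇔ with <-cmp d k | cornerCut?
    ... | tri< d<k _ _ | _ = diagonalToRightSide (<⇒≤ d<k) (λ _ → d<k)
    ... | tri≈ _ d≡k _ | no ¬cut = diagonalToRightSide (≤-reflexive d≡k) (⊥-elim ∘ ¬cut)
    ... | tri≈ _ d≡k _ | yes cut = diagonalToCut d≡k cut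
    ... | tri> _ _ k<d | _ = diagonalToBottom k<d

  module LeftColumn (r₀ : ℕ) (2≤r₀ : 2 ≤ r₀) (r₀≤k : r₀ ≤ k) where
    1≤r₀ : 1 ≤ r₀
    1≤r₀ = <⇒≤ 2≤r₀

    module _ (p : ℕ)
      (ordinaryRows : ∀ r → r₀ ≤ r → r ≤ k → ¬ (r ≡ k × CornerCut) → m + r₀ ≤ r ⇔ r₀ + p ≤ r)
      (cutRow : CornerCut → m + r₀ ≤ suc k ⇔ r₀ + p ≤ k)
      (ordinaryColumns : ∀ c → c ≤ m → ¬ (c ≡ m × CornerCut) → r₀ + c ≤ suc k ⇔ c ≤ p)
      (cutColumn : CornerCut → m + r₀ ≤ k ⇔ m ≤ p) where
      open Equivalence

      exchange : Exchange (Cyc k n (m + r₀)) r₀ 1 p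
      exchange = record { sources = sources ; sinks = sinks }
        where
        window = Cyc-wrapped k+m≡n 1≤r₀ r₀≤k
        sources : ∀ r → 1 ≤ r → r ≤ k → Cyc k n (m + r₀) (srcLabel D r) ⇔ (¬ (r₀ ≤ r × r < r₀ + p))
        sources r 1≤r r≤k with srcLabel-cases r
        ... | inj₁ (ordinary , label≡r) rewrite label≡r = mk⇔ to′ from′
          where
          to′ : Cyc k n (m + r₀) r → ¬ (r₀ ≤ r × r < r₀ + p)
          to′ cyc (r₀≤r , r<r₀+p) with to (window r) cyc
          ... | inj₁ (m+r₀≤r , _) = <⇒≱ r<r₀+p (to (ordinaryRows r r₀≤r r≤k ordinary) m+r₀≤r)
          ... | inj₂ (_ , r<r₀) = <⇒≱ r<r₀ r₀≤r
          from′ : ¬ (r₀ ≤ r × r < r₀ + p) → Cyc k n (m + r₀) r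
          from′ outside with r₀ ≤? r
          ... | no r₀≰r = from (window r) (inj₂ (1≤r , ≰⇒> r₀≰r))
          ... | yes r₀≤r = from (window r) (inj₁ (from (ordinaryRows r r₀≤r r≤k ordinary)
                                                        (to (outsideWindow⇔ r₀≤r) outside) , ≤-trans r≤k k≤n))
        ... | inj₂ (r≡k , cut , label≡1+k) rewrite label≡1+k | r≡k = mk⇔ to′ from′
          where
          to′ : Cyc k n (m + r₀) (suc k) → ¬ (r₀ ≤ k × k < r₀ + p)
          to′ cyc (_ , k<r₀+p) with to (window (suc k)) cyc
          ... | inj₁ (m+r₀≤1+k , _) = <⇒≱ k<r₀+p (to (cutRow cut) m+r₀≤1+k)
          ... | inj₂ (_ , 1+k<r₀) = <⇒≱ 1+k<r₀ (m≤n⇒m≤1+n r₀≤k)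
          from′ : ¬ (r₀ ≤ k × k < r₀ + p) → Cyc k n (m + r₀) (suc k)
          from′ outside = from (window (suc k))
            (inj₁ (from (cutRow cut) (to (outsideWindow⇔ r₀≤k) outside) ,
                   subst (_≤ n) (+-comm k 1) (≤-trans (+-monoʳ-≤ k 1≤m) (≤-reflexive k+m≡n))))
        sinks : ∀ c → 1 ≤ c → c ≤ m → Cyc k n (m + r₀) (snkLabel D c) ⇔ (1 ≤ c × c < 1 + p)
        sinks c 1≤c c≤m with snkLabel-cases c c≤m
        ... | inj₁ (ordinary , S+c≡1+n) = mk⇔ to′ from′
          where
          S+c≡ : snkLabel D c + c ≡ suc (k + m)
          S+c≡ = trans S+c≡1+n (cong suc (sym k+m≡n))
          to′ : Cyc k n (m + r₀) (snkLabel D c) → 1 ≤ c × c < 1 + p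
          to′ cyc with to (window _) cyc
          ... | inj₁ (m+r₀≤S , _) =
            1≤c , s≤s (to (ordinaryColumns c c≤m ordinary) (to (sinkLabel-wrapped⇔ S+c≡) m+r₀≤S))
          ... | inj₂ (_ , S<r₀) = ⊥-elim (<-asym S<r₀ (≤-<-trans r₀≤k (sinkLabel>rows S+c≡ c≤m)))
          from′ : 1 ≤ c × c < 1 + p → Cyc k n (m + r₀) (snkLabel D c)
          from′ (_ , c<1+p) = from (window _)
            (inj₁ (from (sinkLabel-wrapped⇔ S+c≡) (from (ordinaryColumns c c≤m ordinary) (≤-pred c<1+p)) ,
                   sinkLabel≤ S+c≡1+n 1≤c))
        ... | inj₂ (c≡m , cut , label≡k) rewrite label≡k | c≡m = mk⇔ to′ from′
          where
          to′ : Cyc k n (m + r₀) k → 1 ≤ m × m < 1 + p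
          to′ cyc with to (window k) cyc
          ... | inj₁ (m+r₀≤k , _) = 1≤m , s≤s (to (cutColumn cut) m+r₀≤k)
          ... | inj₂ (_ , k<r₀) = ⊥-elim (<⇒≱ k<r₀ r₀≤k)
          from′ : 1 ≤ m × m < 1 + p → Cyc k n (m + r₀) k
          from′ (_ , m<1+p) = from (window k) (inj₁ (from (cutColumn cut) (≤-pred m<1+p) , k≤n))

      sizedBlock-basis⇔ : 1 ≤ p → r₀ + p ≤ suc k → p ≤ m → (CornerCut → r₀ + p ≤ k ⊎ suc p ≤ m) →
                          r₀ + p ≡ suc k ⊎ suc p ≡ suc m ⊎ (CornerCut × r₀ + p ≡ k × suc p ≡ m) →
                          IsBasis D (Cyc k n (m + r₀)) ⇔ (¬ A (m + r₀) ≡ true)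
      sizedBlock-basis⇔ 1≤p rows-fit p≤m avoids-cut maximal = block-basis⇔ β exchange (leftColumnDot⇔ 2≤r₀ r₀≤k)
        where
        β : Block
        β = record { a = r₀ ; b = 1 ; p = p ; 1≤a = 1≤r₀ ; 1≤b = ≤-refl ; 1≤p = 1≤p
                   ; rows-fit = rows-fit ; columns-fit = s≤s p≤m
                   ; avoids-cut = avoids-cut ; maximal = maximal }

    diagonalToRightSide : m + r₀ ≤ suc k → (CornerCut → m + r₀ ≤ k) →
                          IsBasis D (Cyc k n (m + r₀)) ⇔ (¬ A (m + r₀) ≡ true)
    diagonalToRightSide m+r₀≤1+k m+r₀≤k-ifCut =
      sizedBlock-basis⇔ m ordinaryRows cutRow ordinaryColumns cutColumn
      1≤m (subst (_≤ suc k) (+-comm m r₀) m+r₀≤1+k) ≤-refl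
      (inj₁ ∘ subst (_≤ k) (+-comm m r₀) ∘ m+r₀≤k-ifCut) (inj₂ (inj₁ refl))
      where
      ordinaryRows : ∀ r → r₀ ≤ r → r ≤ k → ¬ (r ≡ k × CornerCut) → m + r₀ ≤ r ⇔ r₀ + m ≤ r
      ordinaryRows r _ _ _ = mk⇔ (subst (_≤ r) (+-comm m r₀)) (subst (_≤ r) (+-comm r₀ m))
      cutRow : CornerCut → m + r₀ ≤ suc k ⇔ r₀ + m ≤ k
      cutRow cut = both-true⇔ m+r₀≤1+k (subst (_≤ k) (+-comm m r₀) (m+r₀≤k-ifCut cut))
      ordinaryColumns : ∀ c → c ≤ m → ¬ (c ≡ m × CornerCut) → r₀ + c ≤ suc k ⇔ c ≤ m
      ordinaryColumns c c≤m _ =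
        both-true⇔ (≤-trans (+-monoʳ-≤ r₀ c≤m) (subst (_≤ suc k) (+-comm m r₀) m+r₀≤1+k)) c≤m
      cutColumn : CornerCut → m + r₀ ≤ k ⇔ m ≤ m
      cutColumn cut = both-true⇔ (m+r₀≤k-ifCut cut) ≤-refl

    diagonalToCut : m + r₀ ≡ suc k → CornerCut → IsBasis D (Cyc k n (m + r₀)) ⇔ (¬ A (m + r₀) ≡ true)
    diagonalToCut m+r₀≡1+k cut = sizedBlock-basis⇔ (pred m) ordinaryRows cutRow ordinaryColumns cutColumn
      (<⇒≤pred 2≤m) (≤-trans (≤-reflexive r₀+[m-1]≡k) (n≤1+n k))
      (≤-trans (n≤1+n (pred m)) (≤-reflexive 1+[m-1]≡m))
      (λ _ → inj₁ (≤-reflexive r₀+[m-1]≡k)) (inj₂ (inj₂ (cut , r₀+[m-1]≡k , 1+[m-1]≡m)))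
      where
      1+[m-1]≡m : suc (pred m) ≡ m
      1+[m-1]≡m = suc-pred m ⦃ >-nonZero 1≤m ⦄
      r₀+[m-1]≡k : r₀ + pred m ≡ k
      r₀+[m-1]≡k = suc-injective (begin
        suc (r₀ + pred m) ≡⟨ +-suc r₀ (pred m) ⟨
        r₀ + suc (pred m) ≡⟨ cong (r₀ +_) 1+[m-1]≡m ⟩
        r₀ + m            ≡⟨ +-comm r₀ m ⟩
        m + r₀            ≡⟨ m+r₀≡1+k ⟩
        suc k             ∎)
        where open ≡-Reasoning
      ordinaryRows : ∀ r → r₀ ≤ r → r ≤ k → ¬ (r ≡ k × CornerCut) → m + r₀ ≤ r ⇔ r₀ + pred m ≤ r
      ordinaryRows r _ r≤k ordinary = both-false⇔
        (λ m+r₀≤r → <⇒≱ (subst (_≤ r) m+r₀≡1+k m+r₀≤r) r≤k)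
        (λ r₀+[m-1]≤r → ordinary (≤-antisym r≤k (subst (_≤ r) r₀+[m-1]≡k r₀+[m-1]≤r) , cut))
      cutRow : CornerCut → m + r₀ ≤ suc k ⇔ r₀ + pred m ≤ k
      cutRow _ = both-true⇔ (≤-reflexive m+r₀≡1+k) (≤-reflexive r₀+[m-1]≡k)
      ordinaryColumns : ∀ c → c ≤ m → ¬ (c ≡ m × CornerCut) → r₀ + c ≤ suc k ⇔ c ≤ pred m
      ordinaryColumns c c≤m ordinary = both-true⇔
        (≤-trans (+-monoʳ-≤ r₀ c≤m) (≤-reflexive (trans (+-comm r₀ m) m+r₀≡1+k)))
        (<⇒≤pred (≤∧≢⇒< c≤m λ c≡m → ordinary (c≡m , cut)))
      cutColumn : CornerCut → m + r₀ ≤ k ⇔ m ≤ pred m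
      cutColumn _ = both-false⇔
        (λ m+r₀≤k → <-irrefl refl (subst (_≤ k) m+r₀≡1+k m+r₀≤k))
        (<⇒≱ (subst (pred m <_) 1+[m-1]≡m ≤-refl))

    diagonalToBottom : suc k < m + r₀ → IsBasis D (Cyc k n (m + r₀)) ⇔ (¬ A (m + r₀) ≡ true)
    diagonalToBottom 1+k<m+r₀ with m≤n⇒∃[o]m+o≡n (m≤n⇒m≤1+n r₀≤k)
    ... | p , r₀+p≡1+k = sizedBlock-basis⇔ p ordinaryRows cutRow ordinaryColumns cutColumn
      1≤p (≤-reflexive r₀+p≡1+k) (<⇒≤ p<m) (λ _ → inj₂ p<m) (inj₁ r₀+p≡1+k)
      where
      p<m : p < m
      p<m = +-cancelʳ-< r₀ p m (subst (_< m + r₀) (trans (sym r₀+p≡1+k) (+-comm r₀ p)) 1+k<m+r₀)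
      1≤p : 1 ≤ p
      1≤p = +-cancelˡ-≤ r₀ 1 p
              (subst (r₀ + 1 ≤_) (sym r₀+p≡1+k) (subst (_≤ suc k) (+-comm 1 r₀) (s≤s r₀≤k)))
      ordinaryRows : ∀ r → r₀ ≤ r → r ≤ k → ¬ (r ≡ k × CornerCut) → m + r₀ ≤ r ⇔ r₀ + p ≤ r
      ordinaryRows r _ r≤k _ = both-false⇔
        (λ m+r₀≤r → <⇒≱ (≤-trans 1+k<m+r₀ m+r₀≤r) (m≤n⇒m≤1+n r≤k))
        (λ r₀+p≤r → <⇒≱ (subst (_≤ r) r₀+p≡1+k r₀+p≤r) r≤k)
      cutRow : CornerCut → m + r₀ ≤ suc k ⇔ r₀ + p ≤ k
      cutRow _ = both-false⇔ (<⇒≱ 1+k<m+r₀) (λ r₀+p≤k → <-irrefl refl (subst (_≤ k) r₀+p≡1+k r₀+p≤k))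
      ordinaryColumns : ∀ c → c ≤ m → ¬ (c ≡ m × CornerCut) → r₀ + c ≤ suc k ⇔ c ≤ p
      ordinaryColumns c _ _ = mk⇔
        (λ r₀+c≤1+k → +-cancelˡ-≤ r₀ c p (subst (r₀ + c ≤_) (sym r₀+p≡1+k) r₀+c≤1+k))
        (λ c≤p → subst (r₀ + c ≤_) r₀+p≡1+k (+-monoʳ-≤ r₀ c≤p))
      cutColumn : CornerCut → m + r₀ ≤ k ⇔ m ≤ p
      cutColumn _ = both-false⇔ (λ m+r₀≤k → <⇒≱ 1+k<m+r₀ (m≤n⇒m≤1+n m+r₀≤k)) (<⇒≱ p<m)

    leftColumn-basis⇔ : IsBasis D (Cyc k n (m + r₀)) ⇔ (¬ A (m + r₀) ≡ true)
    leftColumn-basis⇔ with <-cmp (m + r₀) (suc k) | cornerCut?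
    ... | tri< m+r₀<1+k _ _ | _ = diagonalToRightSide (<⇒≤ m+r₀<1+k) (λ _ → ≤-pred m+r₀<1+k)
    ... | tri≈ _ m+r₀≡1+k _ | no ¬cut = diagonalToRightSide (≤-reflexive m+r₀≡1+k) (⊥-elim ∘ ¬cut)
    ... | tri≈ _ m+r₀≡1+k _ | yes cut = diagonalToCut m+r₀≡1+k cut
    ... | tri> _ _ 1+k<m+r₀ | _ = diagonalToBottom 1+k<m+r₀

  module Corner where
    open Equivalence

    window : ∀ x → Cyc k n 1 x ⇔ (0 < x × x ≤ k)
    window = Cyc-unwrapped k≤n

    exchange : ¬ CornerCut → Exchange (Cyc k n 1) 1 (suc m) 0
    exchange ¬cut = record { sources = sources ; sinks = sinks }
      where
      sources : ∀ r → 1 ≤ r → r ≤ k → Cyc k n 1 (srcLabel D r) ⇔ (¬ (1 ≤ r × r < 1 + 0))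
      sources r 1≤r r≤k = both-true⇔
        (from (window _)
          (subst (λ x → 0 < x × x ≤ k) (sym (srcLabel-ordinary r (¬cut ∘ proj₂))) (1≤r , r≤k)))
        (λ (_ , r<1) → <⇒≱ r<1 1≤r)
      sinks : ∀ c → 1 ≤ c → c ≤ m → Cyc k n 1 (snkLabel D c) ⇔ (suc m ≤ c × c < suc m + 0)
      sinks c _ c≤m = both-false⇔
        (λ cyc → <⇒≱ (sinkLabel>rows S+c≡ c≤m) (proj₂ (to (window _) cyc)))
        (λ (m<c , _) → <⇒≱ m<c c≤m)
        where
        S+c≡ : snkLabel D c + c ≡ suc (k + m)
        S+c≡ = trans (snkLabel-ordinary c c≤m (¬cut ∘ proj₂)) (cong suc (sym k+m≡n))

    blocked : CornerCut → ¬ IsBasis D (Cyc k n 1)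
    blocked cut (P , realizes) = lastRowUnroutable (endOK P k 1≤k ≤-refl)
      where
      endLabel≤k : label D (end P k) ≤ k
      endLabel≤k = proj₂ (to (window _) (from (realizes _) (k , (1≤k , ≤-refl) , refl)))
      lastRowUnroutable : (end P k ≡ src k ⊎ ∃ λ c → (1 ≤ c × c ≤ m) × end P k ≡ snk c) → ⊥
      lastRowUnroutable (inj₁ trivial) =
        <-irrefl refl (subst (_≤ k) (trans (cong (label D) trivial) (srcLabel-cut cut)) endLabel≤k)
      lastRowUnroutable (inj₂ (c , (_ , c≤m) , atSink)) with snkLabel-cases c c≤m
      ... | inj₁ (_ , S+c≡1+n) =
        <⇒≱ (sinkLabel>rows (trans S+c≡1+n (cong suc (sym k+m≡n))) c≤m)
            (subst (_≤ k) (cong (label D) atSink) endLabel≤k)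
      ... | inj₂ (c≡m , _ , _) =
        <⇒≱ m∸1<m (subst₂ _≤_ c≡m (len-cut cut) (reachableColumn≤len (path P k 1≤k ≤-refl) atSink))

    corner-basis⇔ : IsBasis D (Cyc k n 1) ⇔ (¬ A 1 ≡ true)
    corner-basis⇔ with cornerCut?
    ... | yes cut = both-false⇔ (blocked cut) (λ ¬cut → ¬cut cut)
    ... | no ¬cut = both-true⇔
      (HookSystem.hooks-realize 1 (suc m) 0 ≤-refl (s≤s z≤n) (λ _ ()) (exchange ¬cut) (λ _ → proj₁)) ¬cut

  Cyc-basis⇔ : ∀ i → 1 ≤ i → i ≤ n → IsBasis D (Cyc k n i) ⇔ (¬ A i ≡ true)
  Cyc-basis⇔ (suc zero) _ _ = Corner.corner-basis⇔
  Cyc-basis⇔ (suc (suc d)) _ i≤n with suc d ≤? m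
  ... | yes 1+d≤m = TopRow.topRow-basis⇔ (suc d) (s≤s z≤n) 1+d≤m
  ... | no 1+d≰m with m≤n⇒∃[o]m+o≡n (≤-trans (n≤1+n m) (m≤n⇒m≤1+n (≰⇒> 1+d≰m)))
  ...   | r₀ , m+r₀≡i =
    subst (λ i → IsBasis D (Cyc k n i) ⇔ (¬ A i ≡ true)) m+r₀≡i
          (LeftColumn.leftColumn-basis⇔ r₀ 2≤r₀ r₀≤k)
    where
    2≤r₀ : 2 ≤ r₀
    2≤r₀ = +-cancelˡ-≤ m 2 r₀ (begin
      m + 2       ≡⟨ +-comm m 2 ⟩
      suc (suc m) ≤⟨ s≤s (≰⇒> 1+d≰m) ⟩
      suc (suc d) ≡⟨ m+r₀≡i ⟨
      m + r₀      ∎)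
      where open ≤-Reasoning
    r₀≤k : r₀ ≤ k
    r₀≤k = +-cancelˡ-≤ m r₀ k (begin
      m + r₀      ≡⟨ m+r₀≡i ⟩
      suc (suc d) ≤⟨ i≤n ⟩
      n           ≡⟨ k+m≡n ⟨
      k + m       ≡⟨ +-comm k m ⟩
      m + k       ∎)
      where open ≤-Reasoning

mainTheorem5 : (k n : ℕ) (A : ℕ → Bool) → 2 ≤ k → k + 2 ≤ n →
               (∀ x → A x ≡ true → 1 ≤ x × x ≤ n) →
               (i : ℕ) → 1 ≤ i → i ≤ n →
               (IsBasis (Dkn k n A) (Cyc k n i) ⇔ (¬ (A i ≡ true)))
-- Only the values of A on [n] are ever inspected, so A ⊆ [n] is not needed.
mainTheorem5 k n A 2≤k k+2≤n _ = Dkn-Positroid.Cyc-basis⇔ k n A 2≤k k+2≤n
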